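{- For all integers $n\ge1$ and $m\in\mathbb{Z}$: \[ \sum_{l=1}^{n}(-1)^l\binom{n}{l}l\,(l+m)_n=(-1)^n(m+n)\,n\,n!, \] \[ \sum_{l=1}^{n}(-1)^l\binom{n}{l}(lm)_{n+1}=\tfrac12(-1)^n m^n(1+m)\,n\,(n+1)!, \] \[ \sum_{l=0}^{n}(-1)^l\binom{n}{l}(l+m-n+1)_n=(-1)^n n!, \] \[ \sum_{l=1}^{n}(-1)^l\binom{n}{l}\bigl((lm)_{n+1}-m^n(l)_{n+1}\bigr)=\tfrac12(-1)^{n+1}m^n(1-m)\,n\,(n+1)!. \] For all integers $n\ge1$ and $m\ge n$: \[ \sum_{l=0}^{n-1}(-1)^l\binom{n}{l}\frac{n-l}{l-m}(1+l)_n=(-1)^n\Bigl(\frac{(m-n)!}{m!}(1+m)_n-1\Bigr)n!, \] \[ \sum_{l=0}^{n-1}(-1)^l\binom{n}{l}\frac{n-l}{l-m}(1-l)_n=(-1)^n\Bigl(\frac{(m-n)!}{m!}(1-m)_n-(-1)^n\Bigr)n!. \] For all positive integers $n,p$ with $n\ge p+1$ and all $m\in\mathbb{Z}$: \[ \sum_{l=0}^{n}(-1)^l\binom{n}{l}l^q(m-n+l+1)_{n-p}=0\quad\text{for every integer }0\le q<p, \qquad \sum_{l=0}^{n}(-1)^l\binom{n}{l}l^p(m-n+l+1)_{n-p}=(-1)^n n!. \]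
   Context: $(a)_k$ denotes the Pochhammer symbol (rising factorial) $(a)_k=a(a+1)\cdots(a+k-1)$ for integers $a$ and $k\ge1$, with $(a)_0=1$. The convention $0^0=1$ is used. -}

module Defs where

open import Data.Nat as ℕ using (ℕ; zero; suc; _∸_)
open import Data.List using (List; map; upTo; foldr)
open import Data.Integer as ℤ using (ℤ; +_)
open import Data.Rational as ℚ using (ℚ; 0ℚ; _/_)
open import Data.Rational.Properties using (_≟_)
open import Relation.Nullary using (yes; no)

poch : ℤ → ℕ → ℤ
poch a zero    = + 1
poch a (suc k) = a ℤ.* poch (a ℤ.+ + 1) k

range : ℕ → ℕ → List ℕ
range a b = map (a ℕ.+_) (upTo (suc b ∸ a))

∑ℤ : ℕ → ℕ → (ℕ → ℤ) → ℤ
∑ℤ a b f = foldr (λ l acc → f l ℤ.+ acc) (+ 0) (range a b)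

∑ℚ : ℕ → ℕ → (ℕ → ℚ) → ℚ
∑ℚ a b f = foldr (λ l acc → f l ℚ.+ acc) 0ℚ (range a b)

ιℤ : ℤ → ℚ
ιℤ z = z / 1

ιℕ : ℕ → ℚ
ιℕ n = ιℤ (+ n)

-- total division on ℚ (x ⊘ 0 = 0); only ever applied to nonzero
-- denominators in the statement
_⊘_ : ℚ → ℚ → ℚ
p ⊘ q with q ≟ 0ℚ
... | yes _  = 0ℚ
... | no q≢0 = ℚ._÷_ p q {{ℚ.≢-nonZero q≢0}}

infixl 7 _⊘_

sgn : ℕ → ℤ
sgn l = (ℤ.- + 1) ℤ.^ l

{-# OPTIONS --safe #-}
-- Every sum is an n-th alternating binomial sum  S_n f = ∑_l (-1)^l C(n,l) f(l).  The Pascal rule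
-- gives S_{n+1} f = - S_n (Δ f), so S_n f = (-1)^n n! c when f is a polynomial of degree n with
-- leading coefficient c, and S_n f = 0 when f has degree < n.  The integer identities follow by
-- writing each summand as such a polynomial, peeling off the degree-(n+1) Pochhammer part when
-- necessary: (l+a)_{n+1} itself contributes (-1)^n (n+1)! (a+n), and (l m)_{n+1} - m^{n+1} (l)_{n+1}
-- has degree n and leading coefficient m^n (1-m) n(n+1)/2.
-- For the two rational identities, C(n,l) (n-l) = n C(n-1,l) turns the sum into an (n-1)-st one.
-- Dividing, (1+l)_n = (l-m) q(l) + (1+m)_n with q of degree n-1 leaves the partial-fraction sum
-- S_k (1/(l-m)) = k! / (-m)_{k+1}; and (1-l)_n vanishes for 1 ≤ l ≤ n, leaving only the term l = 0.
module Submission where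

open import Defs
open import Data.Nat as ℕ using (ℕ; _∸_; _<_; _≤_; _!)
open import Data.Nat.Combinatorics using (_C_)
open import Data.Integer as ℤ using (ℤ; +_)
open import Data.Rational as ℚ using (ℚ; ½)
open import Data.Product using (_×_; _,_)
open import Relation.Binary.PropositionalEquality using (_≡_)
open import Algebra.Bundles using (CommutativeRing)
open import Data.Fin using (Fin; toℕ; inject₁; fromℕ)
import Data.Nat.Properties as ℕP

module AlternatingSum {c ℓ} (R : CommutativeRing c ℓ) where

  open CommutativeRing R
  open import Algebra.Properties.Ring ring using (-1*x≈-x; -‿distribˡ-*)
  open import Algebra.Properties.CommutativeSemigroup *-commutativeSemigroup using (x∙yz≈y∙xz)
  open import Data.Nat using (zero; suc)
  open import Data.Fin.Properties using (toℕ≤pred[n]; toℕ<n; toℕ-inject₁; toℕ-fromℕ)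
  open import Data.List using (map; applyUpTo; foldr)
  import Relation.Binary.PropositionalEquality as ≡
  open import Algebra.Properties.Semiring.Sum semiring
    using (sum; sum-cong-≋; ∑-distrib-+; *-distribˡ-sum; sum-init-last; sum-replicate-zero)
  open import Relation.Binary.Reasoning.Setoid setoid

  -- (-1)^l C(n,l), through the signed Pascal rule so that it lives in any ring.
  signedBinomial : ℕ → ℕ → Carrier
  signedBinomial zero    zero    = 1#
  signedBinomial zero    (suc l) = 0#
  signedBinomial (suc n) zero    = 1#
  signedBinomial (suc n) (suc l) = signedBinomial n (suc l) - signedBinomial n l

  signedBinomial-vanishes : ∀ {n l} → n < l → signedBinomial n l ≈ 0#
  signedBinomial-vanishes {zero}  {suc l} _ = refl
  signedBinomial-vanishes {suc n} {suc l} (ℕ.s≤s n<l) = begin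
    signedBinomial n (suc l) - signedBinomial n l
      ≈⟨ +-cong (signedBinomial-vanishes (ℕP.m<n⇒m<1+n n<l)) (-‿cong (signedBinomial-vanishes n<l)) ⟩
    0# - 0#
      ≈⟨ -‿inverseʳ 0# ⟩
    0# ∎

  alternatingSum : ℕ → (ℕ → Carrier) → Carrier
  alternatingSum n f = sum {suc n} (λ i → signedBinomial n (toℕ i) * f (toℕ i))

  signedBinomial-zero : ∀ n → signedBinomial n 0 ≈ 1#
  signedBinomial-zero zero    = refl
  signedBinomial-zero (suc n) = refl

  sum-init-lastℕ : ∀ n (g : ℕ → Carrier) → sum {suc n} (λ i → g (toℕ i)) ≈ sum {n} (λ i → g (toℕ i)) + g n
  sum-init-lastℕ n g = begin
    sum {suc n} (λ i → g (toℕ i))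
      ≈⟨ sum-init-last (λ i → g (toℕ i)) ⟩
    sum {n} (λ i → g (toℕ (inject₁ i))) + g (toℕ (fromℕ n))
      ≈⟨ +-cong (sum-cong-≋ {n} (λ i → reflexive (≡.cong g (toℕ-inject₁ i)))) (reflexive (≡.cong g (toℕ-fromℕ n))) ⟩
    sum {n} (λ i → g (toℕ i)) + g n ∎

  neg-sum : ∀ n (g : Fin n → Carrier) → - sum g ≈ sum (λ i → - g i)
  neg-sum n g = begin
    - sum g             ≈⟨ sym (-1*x≈-x (sum g)) ⟩
    - 1# * sum g        ≈⟨ *-distribˡ-sum {n} (- 1#) g ⟩
    sum (λ i → - 1# * g i) ≈⟨ sum-cong-≋ {n} (λ i → -1*x≈-x (g i)) ⟩
    sum (λ i → - g i)   ∎

  alternatingSum-cong : ∀ n {f g : ℕ → Carrier} → (∀ {l} → l ≤ n → f l ≈ g l) →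
                        alternatingSum n f ≈ alternatingSum n g
  alternatingSum-cong n f≈g = sum-cong-≋ {suc n} (λ i → *-congˡ {signedBinomial n (toℕ i)} (f≈g (toℕ≤pred[n] i)))

  alternatingSum-distrib-+ : ∀ n (f g : ℕ → Carrier) →
    alternatingSum n (λ l → f l + g l) ≈ alternatingSum n f + alternatingSum n g
  alternatingSum-distrib-+ n f g =
    trans (sum-cong-≋ {suc n} (λ i → distribˡ (signedBinomial n (toℕ i)) (f (toℕ i)) (g (toℕ i))))
          (∑-distrib-+ {suc n} (λ i → signedBinomial n (toℕ i) * f (toℕ i)) (λ i → signedBinomial n (toℕ i) * g (toℕ i)))

  *-distribˡ-alternatingSum : ∀ n x (f : ℕ → Carrier) →
    x * alternatingSum n f ≈ alternatingSum n (λ l → x * f l)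
  *-distribˡ-alternatingSum n x f =
    trans (*-distribˡ-sum {suc n} x (λ i → signedBinomial n (toℕ i) * f (toℕ i)))
          (sum-cong-≋ {suc n} (λ i → x∙yz≈y∙xz x (signedBinomial n (toℕ i)) (f (toℕ i))))

  -‿distrib-alternatingSum : ∀ n (f : ℕ → Carrier) → - alternatingSum n f ≈ alternatingSum n (λ l → - f l)
  -‿distrib-alternatingSum n f = begin
    - alternatingSum n f                       ≈⟨ sym (-1*x≈-x _) ⟩
    - 1# * alternatingSum n f                  ≈⟨ *-distribˡ-alternatingSum n (- 1#) f ⟩
    alternatingSum n (λ l → - 1# * f l)        ≈⟨ alternatingSum-cong n (λ {l} _ → -1*x≈-x (f l)) ⟩
    alternatingSum n (λ l → - f l)             ∎

  alternatingSum-distrib-- : ∀ n (f g : ℕ → Carrier) →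
    alternatingSum n (λ l → f l - g l) ≈ alternatingSum n f - alternatingSum n g
  alternatingSum-distrib-- n f g =
    trans (alternatingSum-distrib-+ n f (λ l → - g l)) (+-congˡ (sym (-‿distrib-alternatingSum n g)))

  alternatingSum-pascal : ∀ n (f : ℕ → Carrier) →
    alternatingSum (suc n) f ≈ alternatingSum n f - alternatingSum n (λ l → f (suc l))
  alternatingSum-pascal n f = begin
    1# * f 0 + sum {suc n} (λ i → (b (suc (toℕ i)) - b (toℕ i)) * f (suc (toℕ i)))
      ≈⟨ +-cong (*-congʳ (sym (signedBinomial-zero n)))
                (trans (sum-cong-≋ {suc n} (λ i → distribʳ (f (suc (toℕ i))) (b (suc (toℕ i))) (- b (toℕ i))))
                       (∑-distrib-+ {suc n} (λ i → b (suc (toℕ i)) * f (suc (toℕ i))) (λ i → - b (toℕ i) * f (suc (toℕ i))))) ⟩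
    b 0 * f 0 + (sum {suc n} (λ i → b (suc (toℕ i)) * f (suc (toℕ i)))
                 + sum {suc n} (λ i → - b (toℕ i) * f (suc (toℕ i))))
      ≈⟨ sym (+-assoc _ _ _) ⟩
    b 0 * f 0 + sum {suc n} (λ i → b (suc (toℕ i)) * f (suc (toℕ i)))
      + sum {suc n} (λ i → - b (toℕ i) * f (suc (toℕ i)))
      ≈⟨ +-cong (+-congˡ dropLast) (trans (sum-cong-≋ {suc n} (λ i → sym (-‿distribˡ-* (b (toℕ i)) (f (suc (toℕ i))))))
                                           (sym (neg-sum (suc n) (λ i → b (toℕ i) * f (suc (toℕ i)))))) ⟩
    alternatingSum n f - alternatingSum n (λ l → f (suc l)) ∎
    where
      b = signedBinomial n
      dropLast : sum {suc n} (λ i → b (suc (toℕ i)) * f (suc (toℕ i))) ≈ sum {n} (λ i → b (suc (toℕ i)) * f (suc (toℕ i)))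
      dropLast = begin
        sum {suc n} (λ i → b (suc (toℕ i)) * f (suc (toℕ i)))
          ≈⟨ sum-init-lastℕ n (λ l → b (suc l) * f (suc l)) ⟩
        sum {n} (λ i → b (suc (toℕ i)) * f (suc (toℕ i))) + b (suc n) * f (suc n)
          ≈⟨ +-congˡ (trans (*-congʳ (signedBinomial-vanishes (ℕP.n<1+n n))) (zeroˡ _)) ⟩
        sum {n} (λ i → b (suc (toℕ i)) * f (suc (toℕ i))) + 0#
          ≈⟨ +-identityʳ _ ⟩
        sum {n} (λ i → b (suc (toℕ i)) * f (suc (toℕ i))) ∎

  private
    foldr-applyUpTo : ∀ a k (h : ℕ → ℕ) (f : ℕ → Carrier) →
      foldr (λ l acc → f l + acc) 0# (map (a ℕ.+_) (applyUpTo h k)) ≡ sum {k} (λ i → f (a ℕ.+ h (toℕ i)))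
    foldr-applyUpTo a zero    h f = ≡.refl
    foldr-applyUpTo a (suc k) h f = ≡.cong (λ s → f (a ℕ.+ h 0) + s) (foldr-applyUpTo a k (λ i → h (suc i)) f)

  range-alternatingSum : ∀ n (g f : ℕ → Carrier) → (∀ {l} → l ≤ n → g l ≈ signedBinomial n l * f l) →
    foldr (λ l acc → g l + acc) 0# (range 0 n) ≈ alternatingSum n f
  range-alternatingSum n g f g≈bf =
    trans (reflexive (foldr-applyUpTo 0 (suc n) (λ l → l) g)) (sum-cong-≋ {suc n} (λ i → g≈bf (toℕ≤pred[n] i)))

  range₁-alternatingSum : ∀ n (g f : ℕ → Carrier) → (∀ l → g l ≈ signedBinomial n l * f l) → f 0 ≈ 0# →
    foldr (λ l acc → g l + acc) 0# (range 1 n) ≈ alternatingSum n f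
  range₁-alternatingSum n g f g≈bf f0≈0 = begin
    foldr (λ l acc → g l + acc) 0# (range 1 n)
      ≈⟨ reflexive (foldr-applyUpTo 1 n (λ l → l) g) ⟩
    sum {n} (λ i → g (suc (toℕ i)))
      ≈⟨ sum-cong-≋ {n} (λ i → g≈bf (suc (toℕ i))) ⟩
    sum {n} (λ i → signedBinomial n (suc (toℕ i)) * f (suc (toℕ i)))
      ≈⟨ sym (+-identityˡ _) ⟩
    0# + sum {n} (λ i → signedBinomial n (suc (toℕ i)) * f (suc (toℕ i)))
      ≈⟨ +-congʳ (sym (trans (*-congˡ f0≈0) (zeroʳ _))) ⟩
    alternatingSum n f ∎

  alternatingSum-head : ∀ n (f : ℕ → Carrier) → (∀ {l} → l < n → f (suc l) ≈ 0#) → alternatingSum n f ≈ f 0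
  alternatingSum-head n f tail≈0 = begin
    signedBinomial n 0 * f 0 + sum {n} (λ i → signedBinomial n (suc (toℕ i)) * f (suc (toℕ i)))
      ≈⟨ +-cong (*-congʳ (signedBinomial-zero n)) (sum-cong-≋ {n} (λ i → trans (*-congˡ (tail≈0 (toℕ<n i))) (zeroʳ _))) ⟩
    1# * f 0 + sum {n} (λ _ → 0#)
      ≈⟨ +-cong (*-identityˡ (f 0)) (sum-replicate-zero n) ⟩
    f 0 + 0#
      ≈⟨ +-identityʳ (f 0) ⟩
    f 0 ∎

module FiniteDifferences where

  open import Data.Nat using (zero; suc)
  open import Data.Integer using (_+_; _*_; -_; _-_)
  import Data.Integer.Properties as ℤP
  open import Data.Integer.Tactic.RingSolver using (solve-∀)
  open import Data.Sum using (inj₁; inj₂)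
  open import Relation.Binary.PropositionalEquality
  open import Data.Nat.Combinatorics using (nCk+nC[k+1]≡[n+1]C[k+1])
  open AlternatingSum ℤP.+-*-commutativeRing public
    using (signedBinomial; alternatingSum; alternatingSum-cong; alternatingSum-distrib-+;
           alternatingSum-distrib--; *-distribˡ-alternatingSum; alternatingSum-pascal; range-alternatingSum; range₁-alternatingSum)

  signedBinomial≡sgn*C : ∀ n l → signedBinomial n l ≡ sgn l * + (n C l)
  signedBinomial≡sgn*C zero    zero    = refl
  signedBinomial≡sgn*C zero    (suc l) = sym (ℤP.*-zeroʳ (sgn (suc l)))
  signedBinomial≡sgn*C (suc n) zero    = refl
  signedBinomial≡sgn*C (suc n) (suc l) = begin
    signedBinomial n (suc l) - signedBinomial n l
      ≡⟨ cong₂ _-_ (signedBinomial≡sgn*C n (suc l)) (signedBinomial≡sgn*C n l) ⟩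
    sgn (suc l) * + (n C suc l) - sgn l * + (n C l)
      ≡⟨ pascal (sgn l) (+ (n C l)) (+ (n C suc l)) ⟩
    sgn (suc l) * (+ (n C l) + + (n C suc l))
      ≡⟨ cong (sgn (suc l) *_) (sym (ℤP.pos-+ (n C l) (n C suc l))) ⟩
    sgn (suc l) * + (n C l ℕ.+ n C suc l)
      ≡⟨ cong (λ x → sgn (suc l) * + x) (nCk+nC[k+1]≡[n+1]C[k+1] n l) ⟩
    sgn (suc l) * + (suc n C suc l) ∎
    where
      open ≡-Reasoning
      pascal : ∀ s a b → (- + 1 * s) * b - s * a ≡ (- + 1 * s) * (a + b)
      pascal = solve-∀

  signedBinomial-absorption : ∀ k l → signedBinomial (suc k) l * (+ suc k - + l) ≡ + suc k * signedBinomial k l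
  signedBinomial-absorption zero    zero          = refl
  signedBinomial-absorption zero    (suc zero)    = refl
  signedBinomial-absorption zero    (suc (suc l)) = refl
  signedBinomial-absorption (suc k) zero          = unit (+ suc (suc k))
    where
      unit : ∀ n → + 1 * (n - + 0) ≡ n * + 1
      unit = solve-∀
  signedBinomial-absorption (suc k) (suc l) = begin
    (a - b) * (+ 1 + K - (+ 1 + L))                ≡⟨ split a b K L ⟩
    a * (K - (+ 1 + L)) + a - b * (K - L)          ≡⟨ cong₂ (λ x y → x + a - y) (signedBinomial-absorption k (suc l))
                                                                                  (signedBinomial-absorption k l) ⟩
    K * signedBinomial k (suc l) + a - K * signedBinomial k l ≡⟨ collect K (signedBinomial k (suc l)) (signedBinomial k l) ⟩
    (+ 1 + K) * a                                  ∎
    where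
      open ≡-Reasoning
      a = signedBinomial (suc k) (suc l)
      b = signedBinomial (suc k) l
      K = + suc k
      L = + l
      split : ∀ a b K L → (a - b) * (+ 1 + K - (+ 1 + L)) ≡ a * (K - (+ 1 + L)) + a - b * (K - L)
      split = solve-∀
      collect : ∀ K c d → K * c + (c - d) - K * d ≡ (+ 1 + K) * (c - d)
      collect = solve-∀

  sgn-square : ∀ n → sgn n * sgn n ≡ + 1
  sgn-square zero    = refl
  sgn-square (suc n) = trans (flip (sgn n)) (sgn-square n)
    where
      flip : ∀ s → (- + 1 * s) * (- + 1 * s) ≡ s * s
      flip = solve-∀

  Δ : (ℕ → ℤ) → ℕ → ℤ
  Δ f l = f (suc l) - f l

  alternatingSum-Δ : ∀ n f → alternatingSum (suc n) f ≡ - alternatingSum n (Δ f)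
  alternatingSum-Δ n f = begin
    alternatingSum (suc n) f
      ≡⟨ alternatingSum-pascal n f ⟩
    alternatingSum n f - alternatingSum n (λ l → f (suc l))
      ≡⟨ swap (alternatingSum n f) (alternatingSum n (λ l → f (suc l))) ⟩
    - (alternatingSum n (λ l → f (suc l)) - alternatingSum n f)
      ≡⟨ cong -_ (sym (alternatingSum-distrib-- n (λ l → f (suc l)) f)) ⟩
    - alternatingSum n (Δ f) ∎
    where
      open ≡-Reasoning
      swap : ∀ a b → a - b ≡ - (b - a)
      swap = solve-∀

  -- Poly d c f: f is a polynomial function of degree at most d with coefficient c at l^d,
  -- witnessed through its differences: Δ^d f is the constant d! c.
  data Poly : ℕ → ℤ → (ℕ → ℤ) → Set where
    constant : ∀ {c f} → (∀ l → f l ≡ c) → Poly 0 c f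
    Δ-poly   : ∀ {d c f} → Poly d (+ suc d * c) (Δ f) → Poly (suc d) c f

  Poly-ext : ∀ {d c f g} → (∀ l → f l ≡ g l) → Poly d c f → Poly d c g
  Poly-ext f≡g (constant f≡c) = constant (λ l → trans (sym (f≡g l)) (f≡c l))
  Poly-ext f≡g (Δ-poly p)     = Δ-poly (Poly-ext (λ l → cong₂ _-_ (f≡g (suc l)) (f≡g l)) p)

  Poly-coefficient : ∀ {d c c′ f} → c ≡ c′ → Poly d c f → Poly d c′ f
  Poly-coefficient refl p = p

  Poly-+ : ∀ {d a b f g} → Poly d a f → Poly d b g → Poly d (a + b) (λ l → f l + g l)
  Poly-+ (constant f≡a) (constant g≡b) = constant (λ l → cong₂ _+_ (f≡a l) (g≡b l))
  Poly-+ {suc d} {a} {b} {f} {g} (Δ-poly p) (Δ-poly q) =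
    Δ-poly (Poly-coefficient (sym (ℤP.*-distribˡ-+ (+ suc d) a b))
             (Poly-ext (λ l → Δ-+ (f (suc l)) (g (suc l)) (f l) (g l)) (Poly-+ p q)))
    where
      Δ-+ : ∀ a b c d → (a - c) + (b - d) ≡ (a + b) - (c + d)
      Δ-+ = solve-∀

  Poly-scale : ∀ {d a f} k → Poly d a f → Poly d (k * a) (λ l → k * f l)
  Poly-scale k (constant f≡a) = constant (λ l → cong (k *_) (f≡a l))
  Poly-scale {suc d} {a} {f} k (Δ-poly p) =
    Δ-poly (Poly-coefficient (reorder k (+ suc d) a)
             (Poly-ext (λ l → Δ-scale k (f (suc l)) (f l)) (Poly-scale k p)))
    where
      reorder : ∀ k n a → k * (n * a) ≡ n * (k * a)
      reorder = solve-∀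
      Δ-scale : ∀ k x y → k * (x - y) ≡ k * x - k * y
      Δ-scale = solve-∀

  Poly-shift : ∀ {d c f} → Poly d c f → Poly d c (λ l → f (suc l))
  Poly-shift (constant f≡c) = constant (λ l → f≡c (suc l))
  Poly-shift (Δ-poly p)     = Δ-poly (Poly-shift p)

  Poly-raise : ∀ {d c f} → Poly d c f → Poly (suc d) (+ 0) f
  Poly-raise (constant {c} f≡c) = Δ-poly (constant (λ l → trans (cong₂ _-_ (f≡c (suc l)) (f≡c l)) (ℤP.+-inverseʳ c)))
  Poly-raise {suc d} (Δ-poly p) = Δ-poly (Poly-coefficient (sym (ℤP.*-zeroʳ (+ suc (suc d)))) (Poly-raise p))

  Poly-raise-< : ∀ {d n c f} → d < n → Poly d c f → Poly n (+ 0) f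
  Poly-raise-< {d} {suc n} (ℕ.s≤s d≤n) p with ℕP.m≤n⇒m<n∨m≡n d≤n
  ... | inj₁ d<n  = Poly-raise (Poly-raise-< d<n p)
  ... | inj₂ refl = Poly-raise p

  Poly-*-id : ∀ {d c g} → Poly d c g → Poly (suc d) c (λ l → + l * g l)
  Poly-*-id {c = c} (constant g≡c) =
    Δ-poly (constant (λ l → trans (cong₂ (λ x y → + suc l * x - + l * y) (g≡c (suc l)) (g≡c l)) (slope (+ l) c)))
    where
      slope : ∀ l c → (+ 1 + l) * c - l * c ≡ + 1 * c
      slope = solve-∀
  Poly-*-id {suc d} {c} {g} (Δ-poly p) =
    Δ-poly (Poly-coefficient (coefficient (+ d) c)
             (Poly-ext (λ l → leibniz (+ l) (g (suc l)) (g l)) (Poly-+ (Poly-*-id p) (Poly-shift {f = g} (Δ-poly p)))))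
    where
      leibniz : ∀ l x y → l * (x - y) + x ≡ (+ 1 + l) * x - l * y
      leibniz = solve-∀
      coefficient : ∀ d c → (+ 1 + d) * c + c ≡ (+ 1 + (+ 1 + d)) * c
      coefficient = solve-∀

  alternatingSum-Poly : ∀ {n c f} → Poly n c f → alternatingSum n f ≡ sgn n * + (n !) * c
  alternatingSum-Poly {c = c} (constant f≡c) = trans (cong (λ x → + 1 * x + + 0) (f≡c 0)) (unit c)
    where
      unit : ∀ c → + 1 * c + + 0 ≡ + 1 * + 1 * c
      unit = solve-∀
  alternatingSum-Poly {suc n} {c} {f} (Δ-poly p) = begin
    alternatingSum (suc n) f                  ≡⟨ alternatingSum-Δ n f ⟩
    - alternatingSum n (Δ f)                  ≡⟨ cong -_ (alternatingSum-Poly p) ⟩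
    - (sgn n * + (n !) * (+ suc n * c))       ≡⟨ reorder (sgn n) (+ (n !)) (+ suc n) c ⟩
    sgn (suc n) * (+ suc n * + (n !)) * c     ≡⟨ cong (λ x → sgn (suc n) * x * c) (sym (ℤP.pos-* (suc n) (n !))) ⟩
    sgn (suc n) * + (suc n !) * c             ∎
    where
      open ≡-Reasoning
      reorder : ∀ s F N c → - (s * F * (N * c)) ≡ (- + 1 * s) * (N * F) * c
      reorder = solve-∀

  alternatingSum-Poly-< : ∀ {d n c f} → d < n → Poly d c f → alternatingSum n f ≡ + 0
  alternatingSum-Poly-< {n = n} d<n p =
    trans (alternatingSum-Poly (Poly-raise-< d<n p)) (ℤP.*-zeroʳ (sgn n * + (n !)))

  poch-snoc : ∀ k x → poch x (suc k) ≡ poch x k * (x + + k)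
  poch-snoc zero    x = trans (ℤP.*-identityʳ x) (sym (trans (ℤP.*-identityˡ (x + + 0)) (ℤP.+-identityʳ x)))
  poch-snoc (suc k) x = begin
    x * poch (x + + 1) (suc k)               ≡⟨ cong (x *_) (poch-snoc k (x + + 1)) ⟩
    x * (poch (x + + 1) k * (x + + 1 + + k))  ≡⟨ reassociate x (poch (x + + 1) k) (+ k) ⟩
    x * poch (x + + 1) k * (x + + suc k)      ∎
    where
      open ≡-Reasoning
      reassociate : ∀ x p k → x * (p * (x + + 1 + k)) ≡ x * p * (x + (+ 1 + k))
      reassociate = solve-∀

  poch-Δ : ∀ k x → poch (x + + 1) (suc k) - poch x (suc k) ≡ + suc k * poch (x + + 1) k
  poch-Δ k x = begin
    poch (x + + 1) (suc k) - x * poch (x + + 1) k            ≡⟨ cong (_- x * poch (x + + 1) k) (poch-snoc k (x + + 1)) ⟩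
    poch (x + + 1) k * (x + + 1 + + k) - x * poch (x + + 1) k ≡⟨ factor x (poch (x + + 1) k) (+ k) ⟩
    + suc k * poch (x + + 1) k                                ∎
    where
      open ≡-Reasoning
      factor : ∀ x p k → p * (x + + 1 + k) - x * p ≡ (+ 1 + k) * p
      factor = solve-∀

  Δ-poch : ∀ k a l → Δ (λ l → poch (+ l + a) (suc k)) l ≡ + suc k * poch (+ l + (a + + 1)) k
  Δ-poch k a l = begin
    poch (+ suc l + a) (suc k) - poch (+ l + a) (suc k)
      ≡⟨ cong (λ x → poch x (suc k) - poch (+ l + a) (suc k)) (shift (+ l) a) ⟩
    poch (+ l + a + + 1) (suc k) - poch (+ l + a) (suc k)
      ≡⟨ poch-Δ k (+ l + a) ⟩
    + suc k * poch (+ l + a + + 1) k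
      ≡⟨ cong (λ x → + suc k * poch x k) (ℤP.+-assoc (+ l) a (+ 1)) ⟩
    + suc k * poch (+ l + (a + + 1)) k ∎
    where
      open ≡-Reasoning
      shift : ∀ l a → + 1 + l + a ≡ l + a + + 1
      shift = solve-∀

  Poly-poch : ∀ k a → Poly k (+ 1) (λ l → poch (+ l + a) k)
  Poly-poch zero    a = constant (λ l → refl)
  Poly-poch (suc k) a = Δ-poly (Poly-ext (λ l → sym (Δ-poch k a l)) (Poly-scale (+ suc k) (Poly-poch k (a + + 1))))

  alternatingSum-poch : ∀ n a → alternatingSum n (λ l → poch (+ l + a) (suc n)) ≡ sgn n * + (suc n !) * (a + + n)
  alternatingSum-poch zero    a = base a
    where
      base : ∀ a → + 1 * ((+ 0 + a) * + 1) + + 0 ≡ + 1 * + 1 * (a + + 0)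
      base = solve-∀
  alternatingSum-poch (suc n) a = begin
    alternatingSum (suc n) (λ l → poch (+ l + a) (suc (suc n)))
      ≡⟨ alternatingSum-Δ n (λ l → poch (+ l + a) (suc (suc n))) ⟩
    - alternatingSum n (Δ (λ l → poch (+ l + a) (suc (suc n))))
      ≡⟨ cong -_ (alternatingSum-cong n (λ {l} _ → Δ-poch (suc n) a l)) ⟩
    - alternatingSum n (λ l → + N * poch (+ l + (a + + 1)) (suc n))
      ≡⟨ cong -_ (sym (*-distribˡ-alternatingSum n (+ N) (λ l → poch (+ l + (a + + 1)) (suc n)))) ⟩
    - (+ N * alternatingSum n (λ l → poch (+ l + (a + + 1)) (suc n)))
      ≡⟨ cong (λ x → - (+ N * x)) (alternatingSum-poch n (a + + 1)) ⟩
    - (+ N * (sgn n * + (suc n !) * (a + + 1 + + n)))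
      ≡⟨ reorder (+ N) (sgn n) (+ (suc n !)) a (+ n) ⟩
    sgn (suc n) * (+ N * + (suc n !)) * (a + + suc n)
      ≡⟨ cong (λ x → sgn (suc n) * x * (a + + suc n)) (sym (ℤP.pos-* N (suc n !))) ⟩
    sgn (suc n) * + (N !) * (a + + suc n) ∎
    where
      open ≡-Reasoning
      N = suc (suc n)
      reorder : ∀ N s F a n → - (N * (s * F * (a + + 1 + n))) ≡ (- + 1 * s) * (N * F) * (a + (+ 1 + n))
      reorder = solve-∀

  ∑ℤ-alternatingSum : ∀ n g f → (∀ l → g l ≡ sgn l * + (n C l) * f l) → ∑ℤ 0 n g ≡ alternatingSum n f
  ∑ℤ-alternatingSum n g f g≡wf =
    range-alternatingSum n g f (λ {l} _ → trans (g≡wf l) (cong (_* f l) (sym (signedBinomial≡sgn*C n l))))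

  ∑ℤ₁-alternatingSum : ∀ n g f → (∀ l → g l ≡ sgn l * + (n C l) * f l) → f 0 ≡ + 0 →
                       ∑ℤ 1 n g ≡ alternatingSum n f
  ∑ℤ₁-alternatingSum n g f g≡wf =
    range₁-alternatingSum n g f (λ l → trans (g≡wf l) (cong (_* f l) (sym (signedBinomial≡sgn*C n l))))

module IntegerSums where

  open import Data.Nat using (zero; suc)
  open import Data.Integer using (_+_; _*_; -_; _-_; _^_)
  import Data.Integer.Properties as ℤP
  open import Data.Integer.Tactic.RingSolver using (solve-∀)
  open import Relation.Binary.PropositionalEquality
  open FiniteDifferences

  Poly-pow-* : ∀ q {d c g} → Poly d c g → Poly (q ℕ.+ d) c (λ l → (+ l) ^ q * g l)
  Poly-pow-* zero    {g = g} p = Poly-ext (λ l → sym (ℤP.*-identityˡ (g l))) p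
  Poly-pow-* (suc q) {g = g} p =
    Poly-ext (λ l → sym (ℤP.*-assoc (+ l) ((+ l) ^ q) (g l))) (Poly-*-id (Poly-pow-* q p))

  alternatingSum-l*poch : ∀ n m → alternatingSum n (λ l → + l * poch (+ l + m) n) ≡ sgn n * (m + + n) * + n * + (n !)
  alternatingSum-l*poch n m = begin
    alternatingSum n (λ l → + l * poch (+ l + m) n)
      ≡⟨ alternatingSum-cong n (λ {l} _ → peel (+ l) m (+ n) (poch (+ l + m) n) (poch-snoc n (+ l + m))) ⟩
    alternatingSum n (λ l → poch (+ l + m) (suc n) - (m + + n) * poch (+ l + m) n)
      ≡⟨ alternatingSum-distrib-- n (λ l → poch (+ l + m) (suc n)) (λ l → (m + + n) * poch (+ l + m) n) ⟩
    alternatingSum n (λ l → poch (+ l + m) (suc n)) - alternatingSum n (λ l → (m + + n) * poch (+ l + m) n)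
      ≡⟨ cong₂ _-_ (alternatingSum-poch n m)
                   (sym (*-distribˡ-alternatingSum n (m + + n) (λ l → poch (+ l + m) n))) ⟩
    sgn n * + (suc n !) * (m + + n) - (m + + n) * alternatingSum n (λ l → poch (+ l + m) n)
      ≡⟨ cong₂ (λ x y → sgn n * x * (m + + n) - (m + + n) * y)
               (ℤP.pos-* (suc n) (n !)) (alternatingSum-Poly (Poly-poch n m)) ⟩
    sgn n * (+ suc n * + (n !)) * (m + + n) - (m + + n) * (sgn n * + (n !) * + 1)
      ≡⟨ collect (sgn n) (+ (n !)) m (+ n) ⟩
    sgn n * (m + + n) * + n * + (n !) ∎
    where
      open ≡-Reasoning
      peel : ∀ l m n P {P′} → P′ ≡ P * (l + m + n) → l * P ≡ P′ - (m + n) * P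
      peel l m n P refl = solver l m n P
        where
          solver : ∀ l m n P → l * P ≡ P * (l + m + n) - (m + n) * P
          solver = solve-∀
      collect : ∀ s F m n → s * ((+ 1 + n) * F) * (m + n) - (m + n) * (s * F * + 1) ≡ s * (m + n) * n * F
      collect = solve-∀

  Poly-poch₀ : ∀ k → Poly k (+ 1) (λ l → poch (+ l) k)
  Poly-poch₀ k = Poly-ext (λ l → cong (λ x → poch x k) (ℤP.+-identityʳ (+ l))) (Poly-poch k (+ 0))

  pochDilationDefect : ℤ → ℕ → ℕ → ℤ
  pochDilationDefect m n l = poch (+ l * m) (suc n) - m ^ suc n * poch (+ l) (suc n)

  -- Doubled so that the leading coefficient m^n (1-m) n(n+1)/2 stays integral.
  Poly-2*pochDilationDefect : ∀ m n →
    Poly n (m ^ n * (+ 1 - m) * + n * + suc n) (λ l → + 2 * pochDilationDefect m n l)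
  Poly-2*pochDilationDefect m zero = constant (λ l → base (+ l) m)
    where
      base : ∀ l m → + 2 * (l * m * + 1 - m * + 1 * (l * + 1)) ≡ + 1 * (+ 1 - m) * + 0 * + 1
      base = solve-∀
  Poly-2*pochDilationDefect m (suc n) =
    subst (λ c → Poly (suc n) c (λ l → + 2 * pochDilationDefect m (suc n) l))
          (coefficient m (m ^ n) (+ n)) (Poly-ext recurrence combined)
    where
      coefficient : ∀ m M n → m * (M * (+ 1 - m) * n * (+ 1 + n)) + (+ 1 + n) * + 0
                                + + 2 * (m * M * ((+ 1 + n) * (+ 1 - m))) * + 1
                              ≡ m * M * (+ 1 - m) * (+ 1 + n) * (+ 1 + (+ 1 + n))
      coefficient = solve-∀
      combined : Poly (suc n) (m * (m ^ n * (+ 1 - m) * + n * + suc n) + + suc n * + 0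
                                 + + 2 * (m ^ suc n * (+ suc n * (+ 1 - m))) * + 1)
                   (λ l → m * (+ l * (+ 2 * pochDilationDefect m n l)) + + suc n * (+ 2 * pochDilationDefect m n l)
                          + + 2 * (m ^ suc n * (+ suc n * (+ 1 - m))) * poch (+ l) (suc n))
      combined = Poly-+ (Poly-+ (Poly-scale m (Poly-*-id (Poly-2*pochDilationDefect m n)))
                                (Poly-scale (+ suc n) (Poly-raise (Poly-2*pochDilationDefect m n))))
                        (Poly-scale (+ 2 * (m ^ suc n * (+ suc n * (+ 1 - m)))) (Poly-poch₀ (suc n)))
      expand : ∀ m M L N P Q →
        m * (L * (+ 2 * (P - m * M * Q))) + N * (+ 2 * (P - m * M * Q)) + + 2 * (m * M * (N * (+ 1 - m))) * Q
          ≡ + 2 * (P * (L * m + N) - m * (m * M) * (Q * (L + N)))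
      expand = solve-∀
      recurrence : ∀ l → m * (+ l * (+ 2 * pochDilationDefect m n l)) + + suc n * (+ 2 * pochDilationDefect m n l)
                           + + 2 * (m ^ suc n * (+ suc n * (+ 1 - m))) * poch (+ l) (suc n)
                         ≡ + 2 * pochDilationDefect m (suc n) l
      recurrence l = trans (expand m (m ^ n) (+ l) (+ suc n) (poch (+ l * m) (suc n)) (poch (+ l) (suc n)))
        (sym (cong₂ (λ x y → + 2 * (x - m ^ suc (suc n) * y)) (poch-snoc (suc n) (+ l * m)) (poch-snoc (suc n) (+ l))))

  alternatingSum-poch₀ : ∀ n → alternatingSum n (λ l → poch (+ l) (suc n)) ≡ sgn n * + (suc n !) * + n
  alternatingSum-poch₀ n = begin
    alternatingSum n (λ l → poch (+ l) (suc n))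
      ≡⟨ alternatingSum-cong n (λ {l} _ → cong (λ x → poch x (suc n)) (sym (ℤP.+-identityʳ (+ l)))) ⟩
    alternatingSum n (λ l → poch (+ l + + 0) (suc n))
      ≡⟨ alternatingSum-poch n (+ 0) ⟩
    sgn n * + (suc n !) * (+ 0 + + n)
      ≡⟨ cong (sgn n * + (suc n !) *_) (ℤP.+-identityˡ (+ n)) ⟩
    sgn n * + (suc n !) * + n ∎
    where open ≡-Reasoning

  2*alternatingSum-poch-dilated : ∀ n m →
    + 2 * alternatingSum n (λ l → poch (+ l * m) (suc n)) ≡ sgn n * m ^ n * (+ 1 + m) * + n * + (suc n !)
  2*alternatingSum-poch-dilated n m = begin
    + 2 * alternatingSum n (λ l → poch (+ l * m) (suc n))
      ≡⟨ *-distribˡ-alternatingSum n (+ 2) (λ l → poch (+ l * m) (suc n)) ⟩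
    alternatingSum n (λ l → + 2 * poch (+ l * m) (suc n))
      ≡⟨ alternatingSum-cong n (λ {l} _ → split (poch (+ l * m) (suc n)) (m ^ suc n) (poch (+ l) (suc n))) ⟩
    alternatingSum n (λ l → + 2 * pochDilationDefect m n l + + 2 * m ^ suc n * poch (+ l) (suc n))
      ≡⟨ alternatingSum-distrib-+ n (λ l → + 2 * pochDilationDefect m n l) (λ l → + 2 * m ^ suc n * poch (+ l) (suc n)) ⟩
    alternatingSum n (λ l → + 2 * pochDilationDefect m n l) + alternatingSum n (λ l → + 2 * m ^ suc n * poch (+ l) (suc n))
      ≡⟨ cong₂ _+_ (alternatingSum-Poly (Poly-2*pochDilationDefect m n))
                   (sym (*-distribˡ-alternatingSum n (+ 2 * m ^ suc n) (λ l → poch (+ l) (suc n)))) ⟩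
    sgn n * + (n !) * (m ^ n * (+ 1 - m) * + n * + suc n) + + 2 * m ^ suc n * alternatingSum n (λ l → poch (+ l) (suc n))
      ≡⟨ cong (λ x → sgn n * + (n !) * (m ^ n * (+ 1 - m) * + n * + suc n) + + 2 * m ^ suc n * x) (alternatingSum-poch₀ n) ⟩
    sgn n * + (n !) * (m ^ n * (+ 1 - m) * + n * + suc n) + + 2 * m ^ suc n * (sgn n * + (suc n !) * + n)
      ≡⟨ cong (λ x → sgn n * + (n !) * (m ^ n * (+ 1 - m) * + n * + suc n) + + 2 * m ^ suc n * (sgn n * x * + n))
              (ℤP.pos-* (suc n) (n !)) ⟩
    sgn n * + (n !) * (m ^ n * (+ 1 - m) * + n * + suc n) + + 2 * m ^ suc n * (sgn n * (+ suc n * + (n !)) * + n)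
      ≡⟨ collect (sgn n) (+ (n !)) (m ^ n) m (+ n) ⟩
    sgn n * m ^ n * (+ 1 + m) * + n * (+ suc n * + (n !))
      ≡⟨ cong (sgn n * m ^ n * (+ 1 + m) * + n *_) (sym (ℤP.pos-* (suc n) (n !))) ⟩
    sgn n * m ^ n * (+ 1 + m) * + n * + (suc n !) ∎
    where
      open ≡-Reasoning
      split : ∀ P M Q → + 2 * P ≡ + 2 * (P - M * Q) + + 2 * M * Q
      split = solve-∀
      collect : ∀ s F M m n → s * F * (M * (+ 1 - m) * n * (+ 1 + n)) + + 2 * (m * M) * (s * ((+ 1 + n) * F) * n)
                              ≡ s * M * (+ 1 + m) * n * ((+ 1 + n) * F)
      collect = solve-∀

  2*alternatingSum-poch-dilated-difference : ∀ n m →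
    + 2 * alternatingSum n (λ l → poch (+ l * m) (suc n) - m ^ n * poch (+ l) (suc n))
      ≡ sgn (suc n) * m ^ n * (+ 1 - m) * + n * + (suc n !)
  2*alternatingSum-poch-dilated-difference n m = begin
    + 2 * alternatingSum n (λ l → poch (+ l * m) (suc n) - m ^ n * poch (+ l) (suc n))
      ≡⟨ cong (+ 2 *_) (alternatingSum-distrib-- n (λ l → poch (+ l * m) (suc n)) (λ l → m ^ n * poch (+ l) (suc n))) ⟩
    + 2 * (alternatingSum n (λ l → poch (+ l * m) (suc n)) - alternatingSum n (λ l → m ^ n * poch (+ l) (suc n)))
      ≡⟨ cong (λ x → + 2 * (alternatingSum n (λ l → poch (+ l * m) (suc n)) - x))
              (sym (*-distribˡ-alternatingSum n (m ^ n) (λ l → poch (+ l) (suc n)))) ⟩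
    + 2 * (alternatingSum n (λ l → poch (+ l * m) (suc n)) - m ^ n * alternatingSum n (λ l → poch (+ l) (suc n)))
      ≡⟨ distribute (alternatingSum n (λ l → poch (+ l * m) (suc n))) (m ^ n) (alternatingSum n (λ l → poch (+ l) (suc n))) ⟩
    + 2 * alternatingSum n (λ l → poch (+ l * m) (suc n)) - + 2 * m ^ n * alternatingSum n (λ l → poch (+ l) (suc n))
      ≡⟨ cong₂ (λ x y → x - + 2 * m ^ n * y) (2*alternatingSum-poch-dilated n m) (alternatingSum-poch₀ n) ⟩
    sgn n * m ^ n * (+ 1 + m) * + n * + (suc n !) - + 2 * m ^ n * (sgn n * + (suc n !) * + n)
      ≡⟨ collect (sgn n) (m ^ n) m (+ n) (+ (suc n !)) ⟩
    sgn (suc n) * m ^ n * (+ 1 - m) * + n * + (suc n !) ∎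
    where
      open ≡-Reasoning
      distribute : ∀ a M b → + 2 * (a - M * b) ≡ + 2 * a - + 2 * M * b
      distribute = solve-∀
      collect : ∀ s M m n F → s * M * (+ 1 + m) * n * F - + 2 * M * (s * F * n) ≡ (- + 1 * s) * M * (+ 1 - m) * n * F
      collect = solve-∀

  alternatingSum-poch-shifted : ∀ n a → alternatingSum n (λ l → poch (+ l + a) n) ≡ sgn n * + (n !)
  alternatingSum-poch-shifted n a = trans (alternatingSum-Poly (Poly-poch n a)) (ℤP.*-identityʳ (sgn n * + (n !)))

  Poly-pow*poch : ∀ q r a → Poly (q ℕ.+ r) (+ 1) (λ l → (+ l) ^ q * poch (+ l + a) r)
  Poly-pow*poch q r a = Poly-pow-* q (Poly-poch r a)

  alternatingSum-pow*poch-vanishes : ∀ {n p q} → q < p → p ≤ n → ∀ a →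
    alternatingSum n (λ l → (+ l) ^ q * poch (+ l + a) (n ∸ p)) ≡ + 0
  alternatingSum-pow*poch-vanishes {n} {p} {q} q<p p≤n a =
    alternatingSum-Poly-< (subst (q ℕ.+ (n ∸ p) <_) (ℕP.m+[n∸m]≡n p≤n) (ℕP.+-monoˡ-< (n ∸ p) q<p))
                          (Poly-pow*poch q (n ∸ p) a)

  alternatingSum-pow*poch : ∀ {n p} → p ≤ n → ∀ a →
    alternatingSum n (λ l → (+ l) ^ p * poch (+ l + a) (n ∸ p)) ≡ sgn n * + (n !)
  alternatingSum-pow*poch {n} {p} p≤n a =
    trans (alternatingSum-Poly (subst (λ d → Poly d (+ 1) (λ l → (+ l) ^ p * poch (+ l + a) (n ∸ p)))
                                      (ℕP.m+[n∸m]≡n p≤n) (Poly-pow*poch p (n ∸ p) a)))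
          (ℤP.*-identityʳ (sgn n * + (n !)))

  poch-neg-factorial : ∀ {n m} → n ≤ m → poch (- + m) n * + ((m ∸ n) !) ≡ sgn n * + (m !)
  poch-neg-factorial {n} {m} n≤m =
    subst (λ m → poch (- + m) n * + ((m ∸ n) !) ≡ sgn n * + (m !)) (ℕP.m+[n∸m]≡n n≤m)
          (subst (λ r → poch (- + (n ℕ.+ (m ∸ n))) n * + (r !) ≡ sgn n * + ((n ℕ.+ (m ∸ n)) !))
                 (sym (ℕP.m+n∸m≡n n (m ∸ n))) (offset n (m ∸ n)))
    where
      step : ∀ x → - (+ 1 + x) + + 1 ≡ - x
      step = solve-∀
      reorder : ∀ N s F → - (+ 1 + N) * (s * F) ≡ (- + 1 * s) * ((+ 1 + N) * F)
      reorder = solve-∀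
      offset : ∀ n r → poch (- + (n ℕ.+ r)) n * + (r !) ≡ sgn n * + ((n ℕ.+ r) !)
      offset zero    r = refl
      offset (suc n) r = begin
        - + suc (n ℕ.+ r) * poch (- + suc (n ℕ.+ r) + + 1) n * + (r !)
          ≡⟨ cong (λ x → - + suc (n ℕ.+ r) * poch x n * + (r !)) (step (+ (n ℕ.+ r))) ⟩
        - + suc (n ℕ.+ r) * poch (- + (n ℕ.+ r)) n * + (r !)
          ≡⟨ ℤP.*-assoc (- + suc (n ℕ.+ r)) (poch (- + (n ℕ.+ r)) n) (+ (r !)) ⟩
        - + suc (n ℕ.+ r) * (poch (- + (n ℕ.+ r)) n * + (r !))
          ≡⟨ cong (- + suc (n ℕ.+ r) *_) (offset n r) ⟩
        - + suc (n ℕ.+ r) * (sgn n * + ((n ℕ.+ r) !))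
          ≡⟨ reorder (+ (n ℕ.+ r)) (sgn n) (+ ((n ℕ.+ r) !)) ⟩
        sgn (suc n) * (+ suc (n ℕ.+ r) * + ((n ℕ.+ r) !))
          ≡⟨ cong (sgn (suc n) *_) (sym (ℤP.pos-* (suc (n ℕ.+ r)) ((n ℕ.+ r) !))) ⟩
        sgn (suc n) * + (suc (n ℕ.+ r) !) ∎
        where open ≡-Reasoning

  poch-one-minus : ∀ {n m} → n ≤ m → (+ 0 - + m) * poch (+ 1 - + m) n * + ((m ∸ n) !) ≡ sgn n * + (m !) * (+ n - + m)
  poch-one-minus {n} {m} n≤m = begin
    (+ 0 - + m) * poch (+ 1 - + m) n * A     ≡⟨ cong₂ (λ x y → x * poch y n * A) (negate (+ m)) (shift (+ m)) ⟩
    poch (- + m) (suc n) * A                  ≡⟨ cong (_* A) (poch-snoc n (- + m)) ⟩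
    poch (- + m) n * (- + m + + n) * A        ≡⟨ swap (poch (- + m) n) (- + m + + n) A ⟩
    poch (- + m) n * A * (- + m + + n)        ≡⟨ cong₂ _*_ (poch-neg-factorial n≤m) (ℤP.+-comm (- + m) (+ n)) ⟩
    sgn n * + (m !) * (+ n - + m)             ∎
    where
      open ≡-Reasoning
      A = + ((m ∸ n) !)
      negate : ∀ m → + 0 - m ≡ - m
      negate = solve-∀
      shift : ∀ m → + 1 - m ≡ - m + + 1
      shift = solve-∀
      swap : ∀ p x a → p * x * a ≡ p * a * x
      swap = solve-∀

  poch-nonpositive-vanishes : ∀ {j k} → j < k → poch (- + j) k ≡ + 0
  poch-nonpositive-vanishes {zero}  {suc k} _ = refl
  poch-nonpositive-vanishes {suc j} {suc k} (ℕ.s≤s j<k) = begin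
    - + suc j * poch (- + suc j + + 1) k ≡⟨ cong (λ x → - + suc j * poch x k) (step (+ j)) ⟩
    - + suc j * poch (- + j) k          ≡⟨ cong (- + suc j *_) (poch-nonpositive-vanishes j<k) ⟩
    - + suc j * + 0                     ≡⟨ ℤP.*-zeroʳ (- + suc j) ⟩
    + 0                                 ∎
    where
      open ≡-Reasoning
      step : ∀ x → - (+ 1 + x) + + 1 ≡ - x
      step = solve-∀

  poch-one : ∀ n → poch (+ 1) n ≡ + (n !)
  poch-one zero    = refl
  poch-one (suc n) = begin
    poch (+ 1) (suc n)           ≡⟨ poch-snoc n (+ 1) ⟩
    poch (+ 1) n * (+ 1 + + n)   ≡⟨ cong (_* + suc n) (poch-one n) ⟩
    + (n !) * + suc n            ≡⟨ ℤP.*-comm (+ (n !)) (+ suc n) ⟩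
    + suc n * + (n !)            ≡⟨ sym (ℤP.pos-* (suc n) (n !)) ⟩
    + (suc n !)                  ∎
    where open ≡-Reasoning

  pochQuotient : ℤ → ℤ → ℕ → ℤ
  pochQuotient x y zero    = + 0
  pochQuotient x y (suc k) = poch (x + + 1) k + y * pochQuotient (x + + 1) (y + + 1) k

  poch-difference : ∀ k x y → poch x k - poch y k ≡ (x - y) * pochQuotient x y k
  poch-difference zero    x y = sym (ℤP.*-zeroʳ (x - y))
  poch-difference (suc k) x y = begin
    x * poch (x + + 1) k - y * poch (y + + 1) k
      ≡⟨ split x y (poch (x + + 1) k) (poch (y + + 1) k) ⟩
    (x - y) * poch (x + + 1) k + y * (poch (x + + 1) k - poch (y + + 1) k)
      ≡⟨ cong (λ z → (x - y) * poch (x + + 1) k + y * z) (poch-difference k (x + + 1) (y + + 1)) ⟩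
    (x - y) * poch (x + + 1) k + y * ((x + + 1 - (y + + 1)) * pochQuotient (x + + 1) (y + + 1) k)
      ≡⟨ collect x y (poch (x + + 1) k) (pochQuotient (x + + 1) (y + + 1) k) ⟩
    (x - y) * pochQuotient x y (suc k) ∎
    where
      open ≡-Reasoning
      split : ∀ x y P P′ → x * P - y * P′ ≡ (x - y) * P + y * (P - P′)
      split = solve-∀
      collect : ∀ x y P Q → (x - y) * P + y * ((x + + 1 - (y + + 1)) * Q) ≡ (x - y) * (P + y * Q)
      collect = solve-∀

  Poly-pochQuotient : ∀ k a y → Poly k (+ 1) (λ l → pochQuotient (+ l + a) y (suc k))
  Poly-pochQuotient k a y =
    subst (λ c → Poly k c (λ l → pochQuotient (+ l + a) y (suc k))) (unit y)
      (Poly-ext (λ l → cong (λ x → poch x k + y * pochQuotient x (y + + 1) k) (sym (ℤP.+-assoc (+ l) a (+ 1))))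
        (Poly-+ (Poly-poch k (a + + 1)) (Poly-scale y (lower k))))
    where
      unit : ∀ y → + 1 + y * + 0 ≡ + 1
      unit = solve-∀
      lower : ∀ k → Poly k (+ 0) (λ l → pochQuotient (+ l + (a + + 1)) (y + + 1) k)
      lower zero    = constant (λ _ → refl)
      lower (suc k) = Poly-raise (Poly-pochQuotient k (a + + 1) (y + + 1))

  ∑ℤ-l*poch : ∀ n m → ∑ℤ 1 n (λ l → sgn l * + (n C l) * + l * poch (+ l + m) n) ≡ sgn n * (m + + n) * + n * + (n !)
  ∑ℤ-l*poch n m =
    trans (∑ℤ₁-alternatingSum n _ (λ l → + l * poch (+ l + m) n) (λ l → ℤP.*-assoc (sgn l * + (n C l)) (+ l) _) refl)
          (alternatingSum-l*poch n m)

  2*∑ℤ-poch-dilated : ∀ n m →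
    + 2 * ∑ℤ 1 n (λ l → sgn l * + (n C l) * poch (+ l * m) (suc n)) ≡ sgn n * m ^ n * (+ 1 + m) * + n * + (suc n !)
  2*∑ℤ-poch-dilated n m =
    trans (cong (+ 2 *_) (∑ℤ₁-alternatingSum n _ (λ l → poch (+ l * m) (suc n)) (λ _ → refl) refl))
          (2*alternatingSum-poch-dilated n m)

  ∑ℤ-poch-shifted : ∀ n m → ∑ℤ 0 n (λ l → sgn l * + (n C l) * poch (+ l + m - + n + + 1) n) ≡ sgn n * + (n !)
  ∑ℤ-poch-shifted n m =
    trans (∑ℤ-alternatingSum n _ (λ l → poch (+ l + (m - + n + + 1)) n)
                             (λ l → cong (λ x → sgn l * + (n C l) * poch x n) (reassociate (+ l) m (+ n))))
          (alternatingSum-poch-shifted n (m - + n + + 1))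
    where
      reassociate : ∀ l m n → l + m - n + + 1 ≡ l + (m - n + + 1)
      reassociate = solve-∀

  2*∑ℤ-poch-dilated-difference : ∀ n m →
    + 2 * ∑ℤ 1 n (λ l → sgn l * + (n C l) * (poch (+ l * m) (suc n) - m ^ n * poch (+ l) (suc n)))
      ≡ sgn (suc n) * m ^ n * (+ 1 - m) * + n * + (suc n !)
  2*∑ℤ-poch-dilated-difference n m =
    trans (cong (+ 2 *_) (∑ℤ₁-alternatingSum n _ (λ l → poch (+ l * m) (suc n) - m ^ n * poch (+ l) (suc n)) (λ _ → refl)
                                             (cong (λ z → + 0 - z) (ℤP.*-zeroʳ (m ^ n)))))
          (2*alternatingSum-poch-dilated-difference n m)

  ∑ℤ-pow*poch-shifted : ∀ n p q m →
    ∑ℤ 0 n (λ l → sgn l * + (n C l) * (+ l) ^ q * poch (m - + n + + l + + 1) (n ∸ p))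
      ≡ alternatingSum n (λ l → (+ l) ^ q * poch (+ l + (m - + n + + 1)) (n ∸ p))
  ∑ℤ-pow*poch-shifted n p q m =
    ∑ℤ-alternatingSum n _ (λ l → (+ l) ^ q * poch (+ l + (m - + n + + 1)) (n ∸ p))
      (λ l → trans (ℤP.*-assoc (sgn l * + (n C l)) ((+ l) ^ q) _)
                   (cong (λ x → sgn l * + (n C l) * ((+ l) ^ q * poch x (n ∸ p))) (reassociate (+ l) m (+ n))))
    where
      reassociate : ∀ l m n → m - n + l + + 1 ≡ l + (m - n + + 1)
      reassociate = solve-∀

module RationalSums where

  open import Level using (0ℓ)
  open import Data.Nat using (zero; suc)
  open import Relation.Nullary.Decidable using (dec⇒maybe)
  open import Data.Empty using (⊥-elim)
  open import Relation.Nullary using (yes; no)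
  import Data.Fin as Fin
  import Data.Vec.Functional as Vec
  open import Data.Rational using (_+_; _*_; -_; _-_; 0ℚ; 1ℚ; 1/_; ≢-nonZero)
  import Data.Rational.Properties as ℚP
  open import Data.Rational.Unnormalised as ℚᵘ using (mkℚᵘ; *≡*)
  import Data.Rational.Unnormalised.Properties as ℚᵘP
  import Data.Integer.Properties as ℤP
  import Data.Integer.Tactic.RingSolver as ℤSolver
  open import Tactic.RingSolver using (solve-∀)
  import Tactic.RingSolver.Core.AlmostCommutativeRing as ACR
  open import Relation.Binary.PropositionalEquality
  open FiniteDifferences
    using (signedBinomial; signedBinomial≡sgn*C; signedBinomial-absorption; sgn-square; alternatingSum; Poly-ext;
           alternatingSum-Poly; poch-snoc)
  open IntegerSums
  open AlternatingSum ℚP.+-*-commutativeRing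
    using () renaming (signedBinomial to signedBinomialℚ; alternatingSum to alternatingSumℚ;
                       alternatingSum-cong to alternatingSumℚ-cong; alternatingSum-pascal to alternatingSumℚ-pascal;
                       alternatingSum-distrib-+ to alternatingSumℚ-distrib-+;
                       *-distribˡ-alternatingSum to *-distribˡ-alternatingSumℚ;
                       alternatingSum-head to alternatingSumℚ-head; range-alternatingSum to range-alternatingSumℚ)

  ℚ-ring : ACR.AlmostCommutativeRing 0ℓ 0ℓ
  ℚ-ring = ACR.fromCommutativeRing ℚP.+-*-commutativeRing (λ x → dec⇒maybe (0ℚ ℚP.≟ x))

  private
    toℚᵘ-ιℤ : ∀ a → ℚ.toℚᵘ (ιℤ a) ℚᵘ.≃ mkℚᵘ a 0
    toℚᵘ-ιℤ a = ℚP.toℚᵘ-fromℚᵘ (mkℚᵘ a 0)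

  ιℤ-homo-+ : ∀ a b → ιℤ (a ℤ.+ b) ≡ ιℤ a + ιℤ b
  ιℤ-homo-+ a b = ℚP.toℚᵘ-injective (begin
    ℚ.toℚᵘ (ιℤ (a ℤ.+ b))                   ≈⟨ toℚᵘ-ιℤ (a ℤ.+ b) ⟩
    mkℚᵘ (a ℤ.+ b) 0                         ≈⟨ *≡* (denominators a b) ⟩
    mkℚᵘ a 0 ℚᵘ.+ mkℚᵘ b 0                   ≈⟨ ℚᵘP.+-cong (toℚᵘ-ιℤ a) (toℚᵘ-ιℤ b) ⟨
    ℚ.toℚᵘ (ιℤ a) ℚᵘ.+ ℚ.toℚᵘ (ιℤ b)         ≈⟨ ℚP.toℚᵘ-homo-+ (ιℤ a) (ιℤ b) ⟨
    ℚ.toℚᵘ (ιℤ a + ιℤ b)                     ∎)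
    where
      open ℚᵘP.≃-Reasoning
      denominators : ∀ a b → (a ℤ.+ b) ℤ.* + 1 ≡ (a ℤ.* + 1 ℤ.+ b ℤ.* + 1) ℤ.* + 1
      denominators = ℤSolver.solve-∀

  ιℤ-homo-* : ∀ a b → ιℤ (a ℤ.* b) ≡ ιℤ a * ιℤ b
  ιℤ-homo-* a b = ℚP.toℚᵘ-injective (begin
    ℚ.toℚᵘ (ιℤ (a ℤ.* b))                   ≈⟨ toℚᵘ-ιℤ (a ℤ.* b) ⟩
    mkℚᵘ (a ℤ.* b) 0                         ≈⟨ *≡* refl ⟩
    mkℚᵘ a 0 ℚᵘ.* mkℚᵘ b 0                   ≈⟨ ℚᵘP.*-cong (toℚᵘ-ιℤ a) (toℚᵘ-ιℤ b) ⟨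
    ℚ.toℚᵘ (ιℤ a) ℚᵘ.* ℚ.toℚᵘ (ιℤ b)         ≈⟨ ℚP.toℚᵘ-homo-* (ιℤ a) (ιℤ b) ⟨
    ℚ.toℚᵘ (ιℤ a * ιℤ b)                     ∎)
    where open ℚᵘP.≃-Reasoning

  ιℤ-homo-*³ : ∀ a b c → ιℤ (a ℤ.* b ℤ.* c) ≡ ιℤ a * ιℤ b * ιℤ c
  ιℤ-homo-*³ a b c = trans (ιℤ-homo-* (a ℤ.* b) c) (cong (_* ιℤ c) (ιℤ-homo-* a b))

  ιℤ-homo‿- : ∀ a → ιℤ (ℤ.- a) ≡ - ιℤ a
  ιℤ-homo‿- a = ℚP.toℚᵘ-injective (begin
    ℚ.toℚᵘ (ιℤ (ℤ.- a))      ≈⟨ toℚᵘ-ιℤ (ℤ.- a) ⟩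
    mkℚᵘ (ℤ.- a) 0            ≈⟨ ℚᵘP.-‿cong (toℚᵘ-ιℤ a) ⟨
    ℚᵘ.- ℚ.toℚᵘ (ιℤ a)        ≈⟨ ℚP.toℚᵘ-homo‿- (ιℤ a) ⟨
    ℚ.toℚᵘ (- ιℤ a)           ∎)
    where open ℚᵘP.≃-Reasoning

  ιℤ-homo-− : ∀ a b → ιℤ (a ℤ.- b) ≡ ιℤ a - ιℤ b
  ιℤ-homo-− a b = trans (ιℤ-homo-+ a (ℤ.- b)) (cong (λ x → ιℤ a + x) (ιℤ-homo‿- b))

  ιℤ-injective : ∀ {a b} → ιℤ a ≡ ιℤ b → a ≡ b
  ιℤ-injective {a} {b} ιa≡ιb
    with ℚᵘP.≃-trans (ℚᵘP.≃-sym (toℚᵘ-ιℤ a)) (ℚᵘP.≃-trans (ℚP.toℚᵘ-cong ιa≡ιb) (toℚᵘ-ιℤ b))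
  ... | *≡* a*1≡b*1 = trans (sym (ℤP.*-identityʳ a)) (trans a*1≡b*1 (ℤP.*-identityʳ b))

  ιℤ-nonZero : ∀ {a} → a ≢ + 0 → ιℤ a ≢ 0ℚ
  ιℤ-nonZero a≢0 ιa≡0 = a≢0 (ιℤ-injective ιa≡0)

  ⊘-split : ∀ p q → p ⊘ q ≡ p * (1ℚ ⊘ q)
  ⊘-split p q with q ℚP.≟ 0ℚ
  ... | yes _   = sym (ℚP.*-zeroʳ p)
  ... | no q≢0 = cong (p *_) (sym (ℚP.*-identityˡ (1/ q)))
    where instance _ = ≢-nonZero q≢0

  ⊘-inverseʳ : ∀ p {q} → q ≢ 0ℚ → (p ⊘ q) * q ≡ p
  ⊘-inverseʳ p {q} q≢0 with q ℚP.≟ 0ℚ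
  ... | yes q≡0 = ⊥-elim (q≢0 q≡0)
  ... | no _    = trans (ℚP.*-assoc p (1/ q) q) (trans (cong (p *_) (ℚP.*-inverseˡ q)) (ℚP.*-identityʳ p))
    where instance _ = ≢-nonZero q≢0

  *-cancelʳ-≡ : ∀ {x y d} → d ≢ 0ℚ → x * d ≡ y * d → x ≡ y
  *-cancelʳ-≡ {x} {y} {d} d≢0 xd≡yd = begin
    x                ≡⟨ sym (ℚP.*-identityʳ x) ⟩
    x * 1ℚ           ≡⟨ cong (x *_) (sym (ℚP.*-inverseʳ d)) ⟩
    x * (d * 1/ d)   ≡⟨ sym (ℚP.*-assoc x d (1/ d)) ⟩
    x * d * 1/ d     ≡⟨ cong (_* 1/ d) xd≡yd ⟩
    y * d * 1/ d     ≡⟨ ℚP.*-assoc y d (1/ d) ⟩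
    y * (d * 1/ d)   ≡⟨ cong (y *_) (ℚP.*-inverseʳ d) ⟩
    y * 1ℚ           ≡⟨ ℚP.*-identityʳ y ⟩
    y                ∎
    where
      open ≡-Reasoning
      instance _ = ≢-nonZero d≢0

  *-≢0 : ∀ {x y} → x ≢ 0ℚ → y ≢ 0ℚ → x * y ≢ 0ℚ
  *-≢0 {x} {y} x≢0 y≢0 xy≡0 = x≢0 (*-cancelʳ-≡ y≢0 (trans xy≡0 (sym (ℚP.*-zeroˡ y))))

  ιℤ-signedBinomial : ∀ n l → ιℤ (signedBinomial n l) ≡ signedBinomialℚ n l
  ιℤ-signedBinomial zero    zero    = refl
  ιℤ-signedBinomial zero    (suc l) = refl
  ιℤ-signedBinomial (suc n) zero    = refl
  ιℤ-signedBinomial (suc n) (suc l) =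
    trans (ιℤ-homo-− (signedBinomial n (suc l)) (signedBinomial n l))
          (cong₂ _-_ (ιℤ-signedBinomial n (suc l)) (ιℤ-signedBinomial n l))

  ιℤ-alternatingSum : ∀ n f → ιℤ (alternatingSum n f) ≡ alternatingSumℚ n (λ l → ιℤ (f l))
  ιℤ-alternatingSum n f =
    ιℤ-foldr {suc n} (λ i → signedBinomial n (toℕ i) ℤ.* f (toℕ i)) (λ i → signedBinomialℚ n (toℕ i) * ιℤ (f (toℕ i)))
      (λ i → trans (ιℤ-homo-* (signedBinomial n (toℕ i)) (f (toℕ i)))
                   (cong (_* ιℤ (f (toℕ i))) (ιℤ-signedBinomial n (toℕ i))))
    where
      ιℤ-foldr : ∀ {N} (t : Fin N → ℤ) (u : Fin N → ℚ) → (∀ i → ιℤ (t i) ≡ u i) →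
                 ιℤ (Vec.foldr ℤ._+_ (+ 0) t) ≡ Vec.foldr _+_ 0ℚ u
      ιℤ-foldr {zero}  t u ιt≡u = refl
      ιℤ-foldr {suc N} t u ιt≡u =
        trans (ιℤ-homo-+ (t Fin.zero) (Vec.foldr ℤ._+_ (+ 0) (λ i → t (Fin.suc i))))
              (cong₂ _+_ (ιt≡u Fin.zero) (ιℤ-foldr (λ i → t (Fin.suc i)) (λ i → u (Fin.suc i)) (λ i → ιt≡u (Fin.suc i))))

  ιℕ-!-nonZero : ∀ m → ιℕ (m !) ≢ 0ℚ
  ιℕ-!-nonZero m = ιℤ-nonZero (λ m!≡0 → ℕ.≢-nonZero⁻¹ (m !) {{m ℕP.!≢0}} (ℤP.+-injective m!≡0))

  -- Only used for l < m, away from the junk value 1 ⊘ 0 = 0.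
  reciprocal : ℕ → ℕ → ℚ
  reciprocal m l = 1ℚ ⊘ ιℤ (+ l ℤ.- + m)

  reciprocal-shift : ∀ m l → reciprocal (suc m) (suc l) ≡ reciprocal m l
  reciprocal-shift m l = cong (λ x → 1ℚ ⊘ ιℤ x) (shift (+ l) (+ m))
    where
      shift : ∀ l m → (+ 1 ℤ.+ l) ℤ.- (+ 1 ℤ.+ m) ≡ l ℤ.- m
      shift = ℤSolver.solve-∀

  ιℤ-difference-nonZero : ∀ {l m} → l ≢ m → ιℤ (+ l ℤ.- + m) ≢ 0ℚ
  ιℤ-difference-nonZero {l} {m} l≢m = ιℤ-nonZero (λ l-m≡0 → l≢m (ℤP.+-injective (ℤP.i-j≡0⇒i≡j (+ l) (+ m) l-m≡0)))

  reciprocal-inverse : ∀ {l m} → l ≢ m → reciprocal m l * ιℤ (+ l ℤ.- + m) ≡ 1ℚ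
  reciprocal-inverse l≢m = ⊘-inverseʳ 1ℚ (ιℤ-difference-nonZero l≢m)

  -- (-m-1)_{k+2} = (-m-1)_{k+1} (k-m) = (-m-1) (-m)_{k+1} matches the two halves of the Pascal rule.
  alternatingSum-reciprocal-poch : ∀ {k m} → k < m →
    alternatingSumℚ k (reciprocal m) * ιℤ (poch (ℤ.- + m) (suc k)) ≡ ιℕ (k !)
  alternatingSum-reciprocal-poch {zero} {suc m} _ = begin
    (1ℚ * reciprocal (suc m) 0 + 0ℚ) * ιℤ (ℤ.- + suc m ℤ.* + 1)
      ≡⟨ cong₂ _*_ (unit (reciprocal (suc m) 0)) (cong ιℤ (negate (+ suc m))) ⟩
    reciprocal (suc m) 0 * ιℤ (+ 0 ℤ.- + suc m)
      ≡⟨ reciprocal-inverse {0} {suc m} (λ ()) ⟩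
    1ℚ ∎
    where
      open ≡-Reasoning
      unit : ∀ x → 1ℚ * x + 0ℚ ≡ x
      unit = solve-∀ ℚ-ring
      negate : ∀ m → ℤ.- m ℤ.* + 1 ≡ + 0 ℤ.- m
      negate = ℤSolver.solve-∀
  alternatingSum-reciprocal-poch {suc k} {suc m} (ℕ.s≤s k<m) = begin
    alternatingSumℚ (suc k) (reciprocal (suc m)) * ιℤ (poch (ℤ.- + suc m) (suc (suc k)))
      ≡⟨ cong (_* ιℤ (poch (ℤ.- + suc m) (suc (suc k)))) pascal ⟩
    (U (suc m) - U m) * ιℤ (poch (ℤ.- + suc m) (suc (suc k)))
      ≡⟨ distribute (U (suc m)) (U m) (ιℤ (poch (ℤ.- + suc m) (suc (suc k)))) ⟩
    U (suc m) * ιℤ (poch (ℤ.- + suc m) (suc (suc k))) - U m * ιℤ (poch (ℤ.- + suc m) (suc (suc k)))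
      ≡⟨ cong₂ (λ x y → U (suc m) * x - U m * y) snoc head ⟩
    U (suc m) * (ιℤ (poch (ℤ.- + suc m) (suc k)) * ιℤ (ℤ.- + suc m ℤ.+ + suc k))
      - U m * (ιℤ (ℤ.- + suc m) * ιℤ (poch (ℤ.- + m) (suc k)))
      ≡⟨ regroup (U (suc m)) (U m) (ιℤ (poch (ℤ.- + suc m) (suc k))) (ιℤ (poch (ℤ.- + m) (suc k)))
                 (ιℤ (ℤ.- + suc m ℤ.+ + suc k)) (ιℤ (ℤ.- + suc m)) ⟩
    U (suc m) * ιℤ (poch (ℤ.- + suc m) (suc k)) * ιℤ (ℤ.- + suc m ℤ.+ + suc k)
      - U m * ιℤ (poch (ℤ.- + m) (suc k)) * ιℤ (ℤ.- + suc m)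
      ≡⟨ cong₂ (λ x y → x * ιℤ (ℤ.- + suc m ℤ.+ + suc k) - y * ιℤ (ℤ.- + suc m))
               (alternatingSum-reciprocal-poch (ℕP.m<n⇒m<1+n k<m)) (alternatingSum-reciprocal-poch k<m) ⟩
    ιℕ (k !) * ιℤ (ℤ.- + suc m ℤ.+ + suc k) - ιℕ (k !) * ιℤ (ℤ.- + suc m)
      ≡⟨ sym (trans (ιℤ-homo-− (+ (k !) ℤ.* (ℤ.- + suc m ℤ.+ + suc k)) (+ (k !) ℤ.* ℤ.- + suc m))
                    (cong₂ _-_ (ιℤ-homo-* (+ (k !)) (ℤ.- + suc m ℤ.+ + suc k)) (ιℤ-homo-* (+ (k !)) (ℤ.- + suc m)))) ⟩
    ιℤ (+ (k !) ℤ.* (ℤ.- + suc m ℤ.+ + suc k) ℤ.- + (k !) ℤ.* ℤ.- + suc m)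
      ≡⟨ cong ιℤ (factorial (+ (k !)) (+ m) (+ k)) ⟩
    ιℤ ((+ 1 ℤ.+ + k) ℤ.* + (k !))
      ≡⟨ cong ιℤ (sym (ℤP.pos-* (suc k) (k !))) ⟩
    ιℕ (suc k !) ∎
    where
      open ≡-Reasoning
      U : ℕ → ℚ
      U m = alternatingSumℚ k (reciprocal m)
      pascal : alternatingSumℚ (suc k) (reciprocal (suc m)) ≡ U (suc m) - U m
      pascal = trans (alternatingSumℚ-pascal k (reciprocal (suc m)))
                     (cong (λ x → U (suc m) - x) (alternatingSumℚ-cong k (λ {l} _ → reciprocal-shift m l)))
      snoc : ιℤ (poch (ℤ.- + suc m) (suc (suc k))) ≡ ιℤ (poch (ℤ.- + suc m) (suc k)) * ιℤ (ℤ.- + suc m ℤ.+ + suc k)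
      snoc = trans (cong ιℤ (poch-snoc (suc k) (ℤ.- + suc m)))
                   (ιℤ-homo-* (poch (ℤ.- + suc m) (suc k)) (ℤ.- + suc m ℤ.+ + suc k))
      head : ιℤ (poch (ℤ.- + suc m) (suc (suc k))) ≡ ιℤ (ℤ.- + suc m) * ιℤ (poch (ℤ.- + m) (suc k))
      head = trans (cong (λ x → ιℤ (ℤ.- + suc m ℤ.* poch x (suc k))) (step (+ m)))
                   (ιℤ-homo-* (ℤ.- + suc m) (poch (ℤ.- + m) (suc k)))
        where
          step : ∀ x → ℤ.- (+ 1 ℤ.+ x) ℤ.+ + 1 ≡ ℤ.- x
          step = ℤSolver.solve-∀
      distribute : ∀ a b c → (a - b) * c ≡ a * c - b * c
      distribute = solve-∀ ℚ-ring
      regroup : ∀ u v p p′ x y → u * (p * x) - v * (y * p′) ≡ u * p * x - v * p′ * y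
      regroup = solve-∀ ℚ-ring
      factorial : ∀ F m k → F ℤ.* (ℤ.- (+ 1 ℤ.+ m) ℤ.+ (+ 1 ℤ.+ k)) ℤ.- F ℤ.* ℤ.- (+ 1 ℤ.+ m) ≡ (+ 1 ℤ.+ k) ℤ.* F
      factorial = ℤSolver.solve-∀

  ιℤ-sgn-square : ∀ n → ιℤ (sgn n) * ιℤ (sgn n) ≡ 1ℚ
  ιℤ-sgn-square n = trans (sym (ιℤ-homo-* (sgn n) (sgn n))) (cong ιℤ (sgn-square n))

  alternatingSum-reciprocal : ∀ {k m} → k < m →
    alternatingSumℚ k (reciprocal m) ≡ ιℤ (sgn (suc k)) * ιℕ (k !) * (ιℕ ((m ∸ suc k) !) ⊘ ιℕ (m !))
  alternatingSum-reciprocal {k} {m} k<m = *-cancelʳ-≡ B≢0 (begin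
    U * B                  ≡⟨ cong (λ x → U * x) (sym (trans (cong (_* B) (ιℤ-sgn-square (suc k))) (ℚP.*-identityˡ B))) ⟩
    U * (s * s * B)        ≡⟨ regroup U s B ⟩
    s * (U * (s * B))      ≡⟨ cong (λ x → s * (U * x)) (sym πA≡sB) ⟩
    s * (U * (π * A))      ≡⟨ reassociate s U π A ⟩
    s * (U * π) * A        ≡⟨ cong₂ (λ x y → s * x * y) (alternatingSum-reciprocal-poch k<m) (sym (⊘-inverseʳ A B≢0)) ⟩
    s * K * ((A ⊘ B) * B)  ≡⟨ sym (ℚP.*-assoc (s * K) (A ⊘ B) B) ⟩
    s * K * (A ⊘ B) * B    ∎)
    where
      open ≡-Reasoning
      U = alternatingSumℚ k (reciprocal m)
      π = ιℤ (poch (ℤ.- + m) (suc k))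
      s = ιℤ (sgn (suc k))
      K = ιℕ (k !)
      A = ιℕ ((m ∸ suc k) !)
      B = ιℕ (m !)
      B≢0 = ιℕ-!-nonZero m
      πA≡sB : π * A ≡ s * B
      πA≡sB = trans (sym (ιℤ-homo-* (poch (ℤ.- + m) (suc k)) (+ ((m ∸ suc k) !))))
                    (trans (cong ιℤ (poch-neg-factorial k<m)) (ιℤ-homo-* (sgn (suc k)) (+ (m !))))
      regroup : ∀ U s B → U * (s * s * B) ≡ s * (U * (s * B))
      regroup = solve-∀ ℚ-ring
      reassociate : ∀ s U π A → s * (U * (π * A)) ≡ s * (U * π) * A
      reassociate = solve-∀ ℚ-ring

  ∑ℚ-absorbed : ∀ k (x y : ℕ → ℚ) →
    ∑ℚ 0 k (λ l → ιℤ (sgn l ℤ.* + (suc k C l)) * (ιℤ (+ suc k ℤ.- + l) ⊘ x l) * y l)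
      ≡ ιℕ (suc k) * alternatingSumℚ k (λ l → y l * (1ℚ ⊘ x l))
  ∑ℚ-absorbed k x y =
    trans (range-alternatingSumℚ k _ (λ l → ιℕ (suc k) * (y l * (1ℚ ⊘ x l))) (λ {l} _ → absorbed l))
          (sym (*-distribˡ-alternatingSumℚ k (ιℕ (suc k)) (λ l → y l * (1ℚ ⊘ x l))))
    where
      open ≡-Reasoning
      weight : ∀ l → ιℤ (sgn l ℤ.* + (suc k C l)) * ιℤ (+ suc k ℤ.- + l) ≡ ιℕ (suc k) * signedBinomialℚ k l
      weight l = begin
        ιℤ (sgn l ℤ.* + (suc k C l)) * ιℤ (+ suc k ℤ.- + l)
          ≡⟨ sym (ιℤ-homo-* (sgn l ℤ.* + (suc k C l)) (+ suc k ℤ.- + l)) ⟩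
        ιℤ (sgn l ℤ.* + (suc k C l) ℤ.* (+ suc k ℤ.- + l))
          ≡⟨ cong (λ b → ιℤ (b ℤ.* (+ suc k ℤ.- + l))) (sym (signedBinomial≡sgn*C (suc k) l)) ⟩
        ιℤ (signedBinomial (suc k) l ℤ.* (+ suc k ℤ.- + l))
          ≡⟨ cong ιℤ (signedBinomial-absorption k l) ⟩
        ιℤ (+ suc k ℤ.* signedBinomial k l)
          ≡⟨ trans (ιℤ-homo-* (+ suc k) (signedBinomial k l)) (cong (ιℕ (suc k) *_) (ιℤ-signedBinomial k l)) ⟩
        ιℕ (suc k) * signedBinomialℚ k l ∎
      absorbed : ∀ l → ιℤ (sgn l ℤ.* + (suc k C l)) * (ιℤ (+ suc k ℤ.- + l) ⊘ x l) * y l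
                       ≡ signedBinomialℚ k l * (ιℕ (suc k) * (y l * (1ℚ ⊘ x l)))
      absorbed l = begin
        w * (a ⊘ x l) * y l                   ≡⟨ cong (λ z → w * z * y l) (⊘-split a (x l)) ⟩
        w * (a * (1ℚ ⊘ x l)) * y l            ≡⟨ regroup w a (1ℚ ⊘ x l) (y l) ⟩
        w * a * (y l * (1ℚ ⊘ x l))            ≡⟨ cong (_* (y l * (1ℚ ⊘ x l))) (weight l) ⟩
        ιℕ (suc k) * signedBinomialℚ k l * (y l * (1ℚ ⊘ x l))
                                              ≡⟨ swap (ιℕ (suc k)) (signedBinomialℚ k l) (y l * (1ℚ ⊘ x l)) ⟩
        signedBinomialℚ k l * (ιℕ (suc k) * (y l * (1ℚ ⊘ x l))) ∎
        where
          w = ιℤ (sgn l ℤ.* + (suc k C l))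
          a = ιℤ (+ suc k ℤ.- + l)
          regroup : ∀ w a r y → w * (a * r) * y ≡ w * a * (y * r)
          regroup = solve-∀ ℚ-ring
          swap : ∀ n b z → n * b * z ≡ b * (n * z)
          swap = solve-∀ ℚ-ring

  poch-quotient-split : ∀ n l m → l ≢ m →
    ιℤ (poch (+ 1 ℤ.+ + l) n) * reciprocal m l
      ≡ ιℤ (pochQuotient (+ 1 ℤ.+ + l) (+ 1 ℤ.+ + m) n) + ιℤ (poch (+ 1 ℤ.+ + m) n) * reciprocal m l
  poch-quotient-split n l m l≢m = begin
    ιℤ (poch x n) * r                           ≡⟨ cong (λ z → ιℤ z * r) (divide (poch x n) (poch y n) (poch-difference n x y)) ⟩
    ιℤ ((+ l ℤ.- + m) ℤ.* Q ℤ.+ poch y n) * r   ≡⟨ cong (_* r) (trans (ιℤ-homo-+ ((+ l ℤ.- + m) ℤ.* Q) (poch y n))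
                                                                  (cong (_+ ιℤ (poch y n)) (ιℤ-homo-* (+ l ℤ.- + m) Q))) ⟩
    (d * ιℤ Q + ιℤ (poch y n)) * r              ≡⟨ expand d (ιℤ Q) (ιℤ (poch y n)) r ⟩
    ιℤ Q * (r * d) + ιℤ (poch y n) * r          ≡⟨ cong (λ z → ιℤ Q * z + ιℤ (poch y n) * r) (reciprocal-inverse l≢m) ⟩
    ιℤ Q * 1ℚ + ιℤ (poch y n) * r               ≡⟨ cong (_+ ιℤ (poch y n) * r) (ℚP.*-identityʳ (ιℤ Q)) ⟩
    ιℤ Q + ιℤ (poch y n) * r                    ∎
    where
      open ≡-Reasoning
      x = + 1 ℤ.+ + l
      y = + 1 ℤ.+ + m
      Q = pochQuotient x y n
      d = ιℤ (+ l ℤ.- + m)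
      r = reciprocal m l
      divide : ∀ P P′ → P ℤ.- P′ ≡ (x ℤ.- y) ℤ.* Q → P ≡ (+ l ℤ.- + m) ℤ.* Q ℤ.+ P′
      divide P P′ eq = trans (restore P P′) (trans (cong (ℤ._+ P′) eq) (shift (+ l) (+ m) Q P′))
        where
          restore : ∀ P P′ → P ≡ (P ℤ.- P′) ℤ.+ P′
          restore = ℤSolver.solve-∀
          shift : ∀ l m Q P′ → ((+ 1 ℤ.+ l) ℤ.- (+ 1 ℤ.+ m)) ℤ.* Q ℤ.+ P′ ≡ (l ℤ.- m) ℤ.* Q ℤ.+ P′
          shift = ℤSolver.solve-∀
      expand : ∀ d q p r → (d * q + p) * r ≡ q * (r * d) + p * r
      expand = solve-∀ ℚ-ring

  ιℤ-sgn-suc : ∀ k → ιℤ (sgn (suc k)) ≡ - ιℤ (sgn k)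
  ιℤ-sgn-suc k = trans (cong ιℤ (ℤP.-1*i≡-i (sgn k))) (ιℤ-homo‿- (sgn k))

  ιℕ-! : ∀ k → ιℕ (suc k !) ≡ ιℕ (suc k) * ιℕ (k !)
  ιℕ-! k = trans (cong ιℤ (ℤP.pos-* (suc k) (k !))) (ιℤ-homo-* (+ suc k) (+ (k !)))

  alternatingSum-pochQuotient : ∀ k m →
    alternatingSum k (λ l → pochQuotient (+ 1 ℤ.+ + l) (+ 1 ℤ.+ + m) (suc k)) ≡ sgn k ℤ.* + (k !) ℤ.* + 1
  alternatingSum-pochQuotient k m =
    alternatingSum-Poly (Poly-ext (λ l → cong (λ z → pochQuotient z (+ 1 ℤ.+ + m) (suc k)) (ℤP.+-comm (+ l) (+ 1)))
                                  (Poly-pochQuotient k (+ 1) (+ 1 ℤ.+ + m)))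

  ∑ℚ-rising : ∀ {k m} → suc k ≤ m →
    ∑ℚ 0 k (λ l → ιℤ (sgn l ℤ.* + (suc k C l)) * (ιℤ (+ suc k ℤ.- + l) ⊘ ιℤ (+ l ℤ.- + m))
                    * ιℤ (poch (+ 1 ℤ.+ + l) (suc k)))
      ≡ ιℤ (sgn (suc k)) * ((ιℕ ((m ∸ suc k) !) ⊘ ιℕ (m !)) * ιℤ (poch (+ 1 ℤ.+ + m) (suc k)) - ιℤ (+ 1)) * ιℕ (suc k !)
  ∑ℚ-rising {k} {m} k<m = begin
    ∑ℚ 0 k (λ l → ιℤ (sgn l ℤ.* + (suc k C l)) * (ιℤ (+ suc k ℤ.- + l) ⊘ ιℤ (+ l ℤ.- + m))
                    * ιℤ (poch (+ 1 ℤ.+ + l) (suc k)))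
      ≡⟨ ∑ℚ-absorbed k (λ l → ιℤ (+ l ℤ.- + m)) (λ l → ιℤ (poch (+ 1 ℤ.+ + l) (suc k))) ⟩
    ιℕ (suc k) * alternatingSumℚ k (λ l → ιℤ (poch (+ 1 ℤ.+ + l) (suc k)) * reciprocal m l)
      ≡⟨ cong (ιℕ (suc k) *_) (alternatingSumℚ-cong k (λ l≤k → poch-quotient-split (suc k) _ m (l≢m l≤k))) ⟩
    ιℕ (suc k) * alternatingSumℚ k (λ l → ιℤ (Q l) + P * reciprocal m l)
      ≡⟨ cong (ιℕ (suc k) *_) (trans (alternatingSumℚ-distrib-+ k (λ l → ιℤ (Q l)) (λ l → P * reciprocal m l))
                                     (cong₂ _+_ (sym (ιℤ-alternatingSum k Q))
                                                (sym (*-distribˡ-alternatingSumℚ k P (reciprocal m))))) ⟩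
    ιℕ (suc k) * (ιℤ (alternatingSum k Q) + P * alternatingSumℚ k (reciprocal m))
      ≡⟨ cong₂ (λ a b → ιℕ (suc k) * (ιℤ a + P * b)) (alternatingSum-pochQuotient k m) (alternatingSum-reciprocal k<m) ⟩
    ιℕ (suc k) * (ιℤ (sgn k ℤ.* + (k !) ℤ.* + 1) + P * (ιℤ (sgn (suc k)) * K * v))
      ≡⟨ cong₂ (λ a b → ιℕ (suc k) * (a + P * (b * K * v)))
               (ιℤ-homo-*³ (sgn k) (+ (k !)) (+ 1))
               (ιℤ-sgn-suc k) ⟩
    ιℕ (suc k) * (s * K * 1ℚ + P * (- s * K * v))
      ≡⟨ collect (ιℕ (suc k)) s K P v ⟩
    - s * (v * P - 1ℚ) * (ιℕ (suc k) * K)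
      ≡⟨ cong₂ (λ a b → a * (v * P - 1ℚ) * b) (sym (ιℤ-sgn-suc k)) (sym (ιℕ-! k)) ⟩
    ιℤ (sgn (suc k)) * (v * P - 1ℚ) * ιℕ (suc k !) ∎
    where
      open ≡-Reasoning
      Q = λ l → pochQuotient (+ 1 ℤ.+ + l) (+ 1 ℤ.+ + m) (suc k)
      P = ιℤ (poch (+ 1 ℤ.+ + m) (suc k))
      K = ιℕ (k !)
      s = ιℤ (sgn k)
      v = ιℕ ((m ∸ suc k) !) ⊘ ιℕ (m !)
      l≢m : ∀ {l} → l ≤ k → l ≢ m
      l≢m l≤k = ℕP.<⇒≢ (ℕP.≤-trans (ℕ.s≤s l≤k) k<m)
      collect : ∀ N s K P v → N * (s * K * 1ℚ + P * (- s * K * v)) ≡ - s * (v * P - 1ℚ) * (N * K)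
      collect = solve-∀ ℚ-ring

  factorialRatio*poch-one-minus : ∀ {n m} → 0 ≢ m → n ≤ m →
    (ιℕ ((m ∸ n) !) ⊘ ιℕ (m !)) * ιℤ (poch (+ 1 ℤ.- + m) n) ≡ ιℤ (sgn n) * ιℤ (+ n ℤ.- + m) * reciprocal m 0
  factorialRatio*poch-one-minus {n} {m} 0≢m n≤m = *-cancelʳ-≡ (*-≢0 (ιℤ-difference-nonZero 0≢m) (ιℕ-!-nonZero m)) (begin
    v * P₁ * (q * B)                ≡⟨ regroup₁ v P₁ q B ⟩
    v * B * (q * P₁)                ≡⟨ cong (_* (q * P₁)) (⊘-inverseʳ A (ιℕ-!-nonZero m)) ⟩
    A * (q * P₁)                    ≡⟨ sym (trans (ιℤ-homo-*³ (+ 0 ℤ.- + m) (poch (+ 1 ℤ.- + m) n) (+ ((m ∸ n) !)))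
                                                  (ℚP.*-comm (q * P₁) A)) ⟩
    ιℤ ((+ 0 ℤ.- + m) ℤ.* poch (+ 1 ℤ.- + m) n ℤ.* + ((m ∸ n) !))
                                    ≡⟨ cong ιℤ (poch-one-minus n≤m) ⟩
    ιℤ (sgn n ℤ.* + (m !) ℤ.* (+ n ℤ.- + m))
                                    ≡⟨ ιℤ-homo-*³ (sgn n) (+ (m !)) (+ n ℤ.- + m) ⟩
    s * B * D                       ≡⟨ regroup₂ s B D ⟩
    s * D * 1ℚ * B                  ≡⟨ cong (λ z → s * D * z * B) (sym (reciprocal-inverse 0≢m)) ⟩
    s * D * (r * q) * B             ≡⟨ regroup₃ s D r q B ⟩
    s * D * r * (q * B)             ∎)
    where
      open ≡-Reasoning
      s = ιℤ (sgn n)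
      A = ιℕ ((m ∸ n) !)
      B = ιℕ (m !)
      v = A ⊘ B
      P₁ = ιℤ (poch (+ 1 ℤ.- + m) n)
      q = ιℤ (+ 0 ℤ.- + m)
      D = ιℤ (+ n ℤ.- + m)
      r = reciprocal m 0
      regroup₁ : ∀ v P q B → v * P * (q * B) ≡ v * B * (q * P)
      regroup₁ = solve-∀ ℚ-ring
      regroup₂ : ∀ s B D → s * B * D ≡ s * D * 1ℚ * B
      regroup₂ = solve-∀ ℚ-ring
      regroup₃ : ∀ s D r q B → s * D * (r * q) * B ≡ s * D * r * (q * B)
      regroup₃ = solve-∀ ℚ-ring

  ∑ℚ-falling : ∀ {k m} → suc k ≤ m →
    ∑ℚ 0 k (λ l → ιℤ (sgn l ℤ.* + (suc k C l)) * (ιℤ (+ suc k ℤ.- + l) ⊘ ιℤ (+ l ℤ.- + m))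
                    * ιℤ (poch (+ 1 ℤ.- + l) (suc k)))
      ≡ ιℤ (sgn (suc k)) * ((ιℕ ((m ∸ suc k) !) ⊘ ιℕ (m !)) * ιℤ (poch (+ 1 ℤ.- + m) (suc k)) - ιℤ (sgn (suc k)))
          * ιℕ (suc k !)
  ∑ℚ-falling {k} {m} k<m = begin
    ∑ℚ 0 k (λ l → ιℤ (sgn l ℤ.* + (suc k C l)) * (ιℤ (+ suc k ℤ.- + l) ⊘ ιℤ (+ l ℤ.- + m))
                    * ιℤ (poch (+ 1 ℤ.- + l) (suc k)))
      ≡⟨ ∑ℚ-absorbed k (λ l → ιℤ (+ l ℤ.- + m)) (λ l → ιℤ (poch (+ 1 ℤ.- + l) (suc k))) ⟩
    ιℕ n * alternatingSumℚ k (λ l → ιℤ (poch (+ 1 ℤ.- + l) n) * reciprocal m l)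
      ≡⟨ cong (ιℕ n *_) (alternatingSumℚ-head k (λ l → ιℤ (poch (+ 1 ℤ.- + l) n) * reciprocal m l) vanishing) ⟩
    ιℕ n * (ιℤ (poch (+ 1) n) * r)
      ≡⟨ cong (λ z → ιℕ n * (ιℤ z * r)) (poch-one n) ⟩
    ιℕ n * (F * r)
      ≡⟨ regroup (ιℕ n) F r ⟩
    1ℚ * (ιℕ n * r) * F
      ≡⟨ cong₂ (λ x y → x * (y * r) * F) (sym (ιℤ-sgn-square n)) n≡D-q ⟩
    s * s * ((D - q) * r) * F
      ≡⟨ expand s D q r F ⟩
    s * (s * D * r - s * (r * q)) * F
      ≡⟨ cong₂ (λ x y → s * (x - s * y) * F) (sym (factorialRatio*poch-one-minus 0≢m k<m)) (reciprocal-inverse 0≢m) ⟩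
    s * (v * P₁ - s * 1ℚ) * F
      ≡⟨ cong (λ z → s * (v * P₁ - z) * F) (ℚP.*-identityʳ s) ⟩
    s * (v * P₁ - s) * F ∎
    where
      open ≡-Reasoning
      n = suc k
      s = ιℤ (sgn n)
      F = ιℕ (n !)
      v = ιℕ ((m ∸ n) !) ⊘ ιℕ (m !)
      P₁ = ιℤ (poch (+ 1 ℤ.- + m) n)
      q = ιℤ (+ 0 ℤ.- + m)
      D = ιℤ (+ n ℤ.- + m)
      r = reciprocal m 0
      0≢m : 0 ≢ m
      0≢m = ℕP.<⇒≢ (ℕP.≤-trans (ℕ.s≤s ℕ.z≤n) k<m)
      vanishing : ∀ {l} → l < k → ιℤ (poch (+ 1 ℤ.- + suc l) n) * reciprocal m (suc l) ≡ 0ℚ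
      vanishing {l} l<k = begin
        ιℤ (poch (+ 1 ℤ.- + suc l) n) * reciprocal m (suc l)
          ≡⟨ cong (λ z → ιℤ (poch z n) * reciprocal m (suc l)) (shift (+ l)) ⟩
        ιℤ (poch (ℤ.- + l) n) * reciprocal m (suc l)
          ≡⟨ cong (λ z → ιℤ z * reciprocal m (suc l)) (poch-nonpositive-vanishes (ℕP.m<n⇒m<1+n l<k)) ⟩
        0ℚ * reciprocal m (suc l)
          ≡⟨ ℚP.*-zeroˡ (reciprocal m (suc l)) ⟩
        0ℚ ∎
        where
          shift : ∀ l → + 1 ℤ.- (+ 1 ℤ.+ l) ≡ ℤ.- l
          shift = ℤSolver.solve-∀
      n≡D-q : ιℕ n ≡ D - q
      n≡D-q = trans (cong ιℤ (cancel (+ n) (+ m))) (ιℤ-homo-− (+ n ℤ.- + m) (+ 0 ℤ.- + m))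
        where
          cancel : ∀ n m → n ≡ (n ℤ.- m) ℤ.- (+ 0 ℤ.- m)
          cancel = ℤSolver.solve-∀
      regroup : ∀ N F r → N * (F * r) ≡ 1ℚ * (N * r) * F
      regroup = solve-∀ ℚ-ring
      expand : ∀ s D q r F → s * s * ((D - q) * r) * F ≡ s * (s * D * r - s * (r * q)) * F
      expand = solve-∀ ℚ-ring

  ιℤ-half : ∀ {x y} → + 2 ℤ.* x ≡ y → ιℤ x ≡ ½ * ιℤ y
  ιℤ-half {x} refl = sym (begin
    ½ * ιℤ (+ 2 ℤ.* x)      ≡⟨ cong (½ *_) (ιℤ-homo-* (+ 2) x) ⟩
    ½ * (ιℤ (+ 2) * ιℤ x)   ≡⟨ sym (ℚP.*-assoc ½ (ιℤ (+ 2)) (ιℤ x)) ⟩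
    ½ * ιℤ (+ 2) * ιℤ x     ≡⟨ ℚP.*-identityˡ (ιℤ x) ⟩
    ιℤ x                    ∎)
    where open ≡-Reasoning

open import Relation.Binary.PropositionalEquality using (trans)
open IntegerSums
open RationalSums

corollary3p2 :
    ((n : ℕ) → 1 ≤ n → (m : ℤ) →
      (∑ℤ 1 n (λ l → sgn l ℤ.* + (n C l) ℤ.* + l ℤ.* poch (+ l ℤ.+ m) n)
        ≡ sgn n ℤ.* (m ℤ.+ + n) ℤ.* + n ℤ.* + (n !))
      × (ιℤ (∑ℤ 1 n (λ l → sgn l ℤ.* + (n C l) ℤ.* poch (+ l ℤ.* m) (ℕ.suc n)))
        ≡ ½ ℚ.* ιℤ (sgn n ℤ.* (m ℤ.^ n) ℤ.* (+ 1 ℤ.+ m) ℤ.* + n ℤ.* + ((ℕ.suc n) !)))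
      × (∑ℤ 0 n (λ l → sgn l ℤ.* + (n C l) ℤ.* poch (+ l ℤ.+ m ℤ.- + n ℤ.+ + 1) n)
        ≡ sgn n ℤ.* + (n !))
      × (ιℤ (∑ℤ 1 n (λ l → sgn l ℤ.* + (n C l)
               ℤ.* (poch (+ l ℤ.* m) (ℕ.suc n) ℤ.- (m ℤ.^ n) ℤ.* poch (+ l) (ℕ.suc n))))
        ≡ ½ ℚ.* ιℤ (sgn (ℕ.suc n) ℤ.* (m ℤ.^ n) ℤ.* (+ 1 ℤ.- m) ℤ.* + n ℤ.* + ((ℕ.suc n) !))))
    × ((n m : ℕ) → 1 ≤ n → n ≤ m →
      (∑ℚ 0 (n ∸ 1) (λ l → ιℤ (sgn l ℤ.* + (n C l))
               ℚ.* (ιℤ (+ n ℤ.- + l) ⊘ ιℤ (+ l ℤ.- + m))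
               ℚ.* ιℤ (poch (+ 1 ℤ.+ + l) n))
        ≡ ιℤ (sgn n) ℚ.* ((ιℕ ((m ∸ n) !) ⊘ ιℕ (m !)) ℚ.* ιℤ (poch (+ 1 ℤ.+ + m) n) ℚ.- ιℤ (+ 1))
            ℚ.* ιℕ (n !))
      × (∑ℚ 0 (n ∸ 1) (λ l → ιℤ (sgn l ℤ.* + (n C l))
               ℚ.* (ιℤ (+ n ℤ.- + l) ⊘ ιℤ (+ l ℤ.- + m))
               ℚ.* ιℤ (poch (+ 1 ℤ.- + l) n))
        ≡ ιℤ (sgn n) ℚ.* ((ιℕ ((m ∸ n) !) ⊘ ιℕ (m !)) ℚ.* ιℤ (poch (+ 1 ℤ.- + m) n) ℚ.- ιℤ (sgn n))
            ℚ.* ιℕ (n !)))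
    × ((n p : ℕ) → 1 ≤ n → 1 ≤ p → ℕ.suc p ≤ n → (m : ℤ) →
      ((q : ℕ) → q < p →
        ∑ℤ 0 n (λ l → sgn l ℤ.* + (n C l) ℤ.* ((+ l) ℤ.^ q) ℤ.* poch (m ℤ.- + n ℤ.+ + l ℤ.+ + 1) (n ∸ p))
          ≡ + 0)
      × (∑ℤ 0 n (λ l → sgn l ℤ.* + (n C l) ℤ.* ((+ l) ℤ.^ p) ℤ.* poch (m ℤ.- + n ℤ.+ + l ℤ.+ + 1) (n ∸ p))
          ≡ sgn n ℤ.* + (n !)))
corollary3p2 =
    (λ n _ m → ∑ℤ-l*poch n m , ιℤ-half (2*∑ℤ-poch-dilated n m)
             , ∑ℤ-poch-shifted n m , ιℤ-half (2*∑ℤ-poch-dilated-difference n m))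
  , (λ { (ℕ.suc k) m _ k<m → ∑ℚ-rising k<m , ∑ℚ-falling k<m })
  , λ n p _ _ p<n m →
        (λ q q<p → trans (∑ℤ-pow*poch-shifted n p q m)
                         (alternatingSum-pow*poch-vanishes q<p (ℕP.<⇒≤ p<n) (m ℤ.- + n ℤ.+ + 1)))
      , trans (∑ℤ-pow*poch-shifted n p p m) (alternatingSum-pow*poch (ℕP.<⇒≤ p<n) (m ℤ.- + n ℤ.+ + 1))
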